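{- Let $(!,\delta,\varepsilon,\Delta,\mathsf e,\mathsf m,\mathsf m_K)$ be a monoidal coalgebra modality on an additive symmetric monoidal category $(\mathbb X,\otimes,K)$. For each object $A$ define $\nabla_A:!A\otimes!A\to!A$ and $\mathsf u_A:K\to!A$ by $\nabla_A=!\big(\rho_A\circ(\varepsilon_A\otimes\mathsf e_A)+\ell_A\circ(\mathsf e_A\otimes\varepsilon_A)\big)\circ\mathsf m_{!A,!A}\circ(\delta_A\otimes\delta_A)$, $\mathsf u_A=!(0_{K,A})\circ\mathsf m_K$. Then $(!A,\nabla_A,\mathsf u_A,\Delta_A,\mathsf e_A)$ is a cocommutative bimonoid, and $(!A\otimes-,\mu,\eta,\mathsf n,\mathsf n_K,\lambda)$ is an exponential lifting monad of $(!,\delta,\varepsilon,\Delta,\mathsf e,\mathsf m,\mathsf m_K)$, where $\mu_X=(\nabla_A\otimes1_X)\circ\alpha_{!A,!A,X}$, $\eta_X=(\mathsf u_A\otimes1_X)\circ\ell_X^{ -1}$, $\mathsf n_{X,Y}=\tau_{!A,!A,X,Y}\circ(\Delta_A\otimes1_{X\otimes Y})$, $\mathsf n_K=\mathsf e_A\circ\rho_{!A}$, and $\lambda_X=\mathsf m_{!A,X}\circ(\delta_A\otimes1_{!X}):!A\otimes!X\to!(!A\otimes X)$.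
   Context: Composition is written $g\circ f$; $(\mathbb X,\otimes,K)$ is symmetric monoidal with associator $\alpha_{A,B,C}:A\otimes(B\otimes C)\to(A\otimes B)\otimes C$, unitors $\ell_A:K\otimes A\to A$, $\rho_A:A\otimes K\to A$, symmetry $\sigma$, interchange iso $\tau_{A,B,C,D}:(A\otimes B)\otimes(C\otimes D)\to(A\otimes C)\otimes(B\otimes D)$. Additive symmetric monoidal category: hom-sets are commutative monoids (sum $+$, zero $0$), composition and $\otimes$ preserve sums and zeros in each argument. Monoidal coalgebra modality: comonad $(!,\delta,\varepsilon)$ with lax symmetric monoidal structure $\mathsf m_{A,B}:!A\otimes!B\to!(A\otimes B)$, $\mathsf m_K:K\to!K$ making $\delta,\varepsilon$ monoidal, and natural $\Delta_A:!A\to!A\otimes!A$, $\mathsf e_A:!A\to K$ making each $!A$ a cocommutative comonoid with $\delta_A$ a comonoid morphism, such that $\Delta_{A\otimes B}\circ\mathsf m_{A,B}=(\mathsf m_{A,B}\otimes\mathsf m_{A,B})\circ\tau\circ(\Delta_A\otimes\Delta_B)$, $\mathsf e_{A\otimes B}\circ\mathsf m_{A,B}=\ell_K\circ(\mathsf e_A\otimes\mathsf e_B)$, $\Delta_K\circ\mathsf m_K=(\mathsf m_K\otimes\mathsf m_K)\circ\ell_K^{ -1}$, $\mathsf e_K\circ\mathsf m_K=1_K$, $!(\Delta_A)\circ\delta_A=\mathsf m_{!A,!A}\circ(\delta_A\otimes\delta_A)\circ\Delta_A$, $!(\mathsf e_A)\circ\delta_A=\mathsf m_K\circ\mathsf e_A$.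 An exponential lifting monad of it is a symmetric comonoidal monad $(\mathsf T,\mu,\eta,\mathsf n,\mathsf n_K)$ (monad with natural $\mathsf n_{A,B}:\mathsf T(A\otimes B)\to\mathsf TA\otimes\mathsf TB$, $\mathsf n_K:\mathsf TK\to K$ making $\mathsf T$ symmetric comonoidal and $\mu,\eta$ comonoidal) with a natural $\lambda_B:\mathsf T!B\to!\mathsf TB$ such that $\lambda_B\circ\mu_{!B}=!(\mu_B)\circ\lambda_{\mathsf TB}\circ\mathsf T(\lambda_B)$, $\lambda_B\circ\eta_{!B}=!(\eta_B)$, $\delta_{\mathsf TB}\circ\lambda_B=!(\lambda_B)\circ\lambda_{!B}\circ\mathsf T(\delta_B)$, $\varepsilon_{\mathsf TB}\circ\lambda_B=\mathsf T(\varepsilon_B)$, $!(\mathsf n_{B,C})\circ\lambda_{B\otimes C}\circ\mathsf T(\mathsf m_{B,C})=\mathsf m_{\mathsf TB,\mathsf TC}\circ(\lambda_B\otimes\lambda_C)\circ\mathsf n_{!B,!C}$, $!(\mathsf n_K)\circ\lambda_K\circ\mathsf T(\mathsf m_K)=\mathsf m_K\circ\mathsf n_K$. -}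

module Defs where

open import Level using (Level; _⊔_) renaming (suc to lsuc)
open import Relation.Binary using (IsEquivalence)

record SymMonCat (o h r : Level) : Set (lsuc (o ⊔ h ⊔ r)) where
  infixr 9 _∘_
  infixr 10 _⊗₀_ _⊗₁_
  infix 4 _≈_
  field
    Obj : Set o
    Hom : Obj → Obj → Set h
    _≈_ : ∀ {A B} → Hom A B → Hom A B → Set r
    ≈-equiv : ∀ {A B} → IsEquivalence (_≈_ {A} {B})
    id  : ∀ {A} → Hom A A
    _∘_ : ∀ {A B C} → Hom B C → Hom A B → Hom A C
    ∘-resp-≈ : ∀ {A B C} {f f' : Hom B C} {g g' : Hom A B} →
               f ≈ f' → g ≈ g' → f ∘ g ≈ f' ∘ g'
    identityˡ : ∀ {A B} {f : Hom A B} → id ∘ f ≈ f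
    identityʳ : ∀ {A B} {f : Hom A B} → f ∘ id ≈ f
    assoc : ∀ {A B C D} {f : Hom A B} {g : Hom B C} {h : Hom C D} →
            (h ∘ g) ∘ f ≈ h ∘ (g ∘ f)
    _⊗₀_ : Obj → Obj → Obj
    _⊗₁_ : ∀ {A B C D} → Hom A B → Hom C D → Hom (A ⊗₀ C) (B ⊗₀ D)
    ⊗-resp-≈ : ∀ {A B C D} {f f' : Hom A B} {g g' : Hom C D} →
               f ≈ f' → g ≈ g' → f ⊗₁ g ≈ f' ⊗₁ g'
    ⊗-identity : ∀ {A C} → id {A} ⊗₁ id {C} ≈ id
    ⊗-homomorphism : ∀ {A B C D E F} {f : Hom A B} {g : Hom B C}
                       {h : Hom D E} {k : Hom E F} →
                     (g ∘ f) ⊗₁ (k ∘ h) ≈ (g ⊗₁ k) ∘ (f ⊗₁ h)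
    K : Obj
    α   : ∀ {A B C} → Hom (A ⊗₀ (B ⊗₀ C)) ((A ⊗₀ B) ⊗₀ C)
    α⁻¹ : ∀ {A B C} → Hom ((A ⊗₀ B) ⊗₀ C) (A ⊗₀ (B ⊗₀ C))
    α-isoˡ : ∀ {A B C} → α⁻¹ ∘ α {A} {B} {C} ≈ id
    α-isoʳ : ∀ {A B C} → α ∘ α⁻¹ {A} {B} {C} ≈ id
    α-natural : ∀ {A A' B B' C C'} {f : Hom A A'} {g : Hom B B'} {h : Hom C C'} →
                α ∘ (f ⊗₁ (g ⊗₁ h)) ≈ ((f ⊗₁ g) ⊗₁ h) ∘ α
    ℓ   : ∀ {A} → Hom (K ⊗₀ A) A
    ℓ⁻¹ : ∀ {A} → Hom A (K ⊗₀ A)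
    ℓ-isoˡ : ∀ {A} → ℓ⁻¹ ∘ ℓ {A} ≈ id
    ℓ-isoʳ : ∀ {A} → ℓ ∘ ℓ⁻¹ {A} ≈ id
    ℓ-natural : ∀ {A B} {f : Hom A B} → ℓ ∘ (id ⊗₁ f) ≈ f ∘ ℓ
    ρ   : ∀ {A} → Hom (A ⊗₀ K) A
    ρ⁻¹ : ∀ {A} → Hom A (A ⊗₀ K)
    ρ-isoˡ : ∀ {A} → ρ⁻¹ ∘ ρ {A} ≈ id
    ρ-isoʳ : ∀ {A} → ρ ∘ ρ⁻¹ {A} ≈ id
    ρ-natural : ∀ {A B} {f : Hom A B} → ρ ∘ (f ⊗₁ id) ≈ f ∘ ρ
    σ : ∀ {A B} → Hom (A ⊗₀ B) (B ⊗₀ A)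
    σ-natural : ∀ {A A' B B'} {f : Hom A A'} {g : Hom B B'} →
                σ ∘ (f ⊗₁ g) ≈ (g ⊗₁ f) ∘ σ
    σ-involutive : ∀ {A B} → σ {B} {A} ∘ σ {A} {B} ≈ id
    triangle : ∀ {A B} → (ρ {A} ⊗₁ id {B}) ∘ α ≈ id ⊗₁ ℓ
    pentagon : ∀ {A B C D} →
               α {A ⊗₀ B} {C} {D} ∘ α {A} {B} {C ⊗₀ D}
               ≈ (α ⊗₁ id) ∘ (α {A} {B ⊗₀ C} {D} ∘ (id ⊗₁ α))
    hexagon : ∀ {A B C} →
              α⁻¹ {B} {C} {A} ∘ (σ {A} {B ⊗₀ C} ∘ α⁻¹)
              ≈ (id ⊗₁ σ) ∘ (α⁻¹ ∘ (σ ⊗₁ id {C}))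

  τ : ∀ {A B C D} → Hom ((A ⊗₀ B) ⊗₀ (C ⊗₀ D)) ((A ⊗₀ C) ⊗₀ (B ⊗₀ D))
  τ {A} {B} {C} {D} =
    α {A} {C} {B ⊗₀ D}
    ∘ (id ⊗₁ (α⁻¹ {C} {B} {D} ∘ ((σ {B} {C} ⊗₁ id) ∘ α {B} {C} {D})))
    ∘ α⁻¹ {A} {B} {C ⊗₀ D}

record Additive {o h r} (𝕏 : SymMonCat o h r) : Set (o ⊔ h ⊔ r) where
  open SymMonCat 𝕏
  infixl 6 _+_
  field
    _+_ : ∀ {A B} → Hom A B → Hom A B → Hom A B
    0h  : ∀ {A B} → Hom A B
    +-resp-≈ : ∀ {A B} {f f' g g' : Hom A B} → f ≈ f' → g ≈ g' → f + g ≈ f' + g'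
    +-assoc : ∀ {A B} {f g h : Hom A B} → (f + g) + h ≈ f + (g + h)
    +-comm  : ∀ {A B} {f g : Hom A B} → f + g ≈ g + f
    +-identityˡ : ∀ {A B} {f : Hom A B} → 0h + f ≈ f
    ∘-distribˡ-+ : ∀ {A B C} {h : Hom B C} {f g : Hom A B} → h ∘ (f + g) ≈ h ∘ f + h ∘ g
    ∘-distribʳ-+ : ∀ {A B C} {f g : Hom B C} {h : Hom A B} → (f + g) ∘ h ≈ f ∘ h + g ∘ h
    ∘-zeroˡ : ∀ {A B C} {f : Hom A B} → 0h {B} {C} ∘ f ≈ 0h
    ∘-zeroʳ : ∀ {A B C} {f : Hom B C} → f ∘ 0h {A} {B} ≈ 0h
    ⊗-distribˡ-+ : ∀ {A B C D} {h : Hom A B} {f g : Hom C D} →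
                   h ⊗₁ (f + g) ≈ h ⊗₁ f + h ⊗₁ g
    ⊗-distribʳ-+ : ∀ {A B C D} {f g : Hom A B} {h : Hom C D} →
                   (f + g) ⊗₁ h ≈ f ⊗₁ h + g ⊗₁ h
    ⊗-zeroˡ : ∀ {A B C D} {f : Hom C D} → 0h {A} {B} ⊗₁ f ≈ 0h
    ⊗-zeroʳ : ∀ {A B C D} {f : Hom A B} → f ⊗₁ 0h {C} {D} ≈ 0h

record IsCocommutativeBimonoid {o h r} (𝕏 : SymMonCat o h r)
    (B : SymMonCat.Obj 𝕏)
    (∇ : SymMonCat.Hom 𝕏 (SymMonCat._⊗₀_ 𝕏 B B) B)
    (u : SymMonCat.Hom 𝕏 (SymMonCat.K 𝕏) B)
    (Δ : SymMonCat.Hom 𝕏 B (SymMonCat._⊗₀_ 𝕏 B B))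
    (ε : SymMonCat.Hom 𝕏 B (SymMonCat.K 𝕏)) : Set r where
  open SymMonCat 𝕏
  field
    ∇-assoc : ∇ ∘ (id ⊗₁ ∇) ≈ ∇ ∘ ((∇ ⊗₁ id) ∘ α)
    ∇-unitˡ : ∇ ∘ (u ⊗₁ id) ≈ ℓ
    ∇-unitʳ : ∇ ∘ (id ⊗₁ u) ≈ ρ
    Δ-coassoc : (Δ ⊗₁ id) ∘ Δ ≈ α ∘ ((id ⊗₁ Δ) ∘ Δ)
    Δ-counitˡ : ℓ ∘ ((ε ⊗₁ id) ∘ Δ) ≈ id
    Δ-counitʳ : ρ ∘ ((id ⊗₁ ε) ∘ Δ) ≈ id
    Δ-cocomm  : σ ∘ Δ ≈ Δ
    Δ-∇ : Δ ∘ ∇ ≈ (∇ ⊗₁ ∇) ∘ (τ ∘ (Δ ⊗₁ Δ))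
    ε-∇ : ε ∘ ∇ ≈ ℓ ∘ (ε ⊗₁ ε)
    Δ-u : Δ ∘ u ≈ (u ⊗₁ u) ∘ ℓ⁻¹
    ε-u : ε ∘ u ≈ id

record MonoidalCoalgebraModality {o h r} (𝕏 : SymMonCat o h r) : Set (o ⊔ h ⊔ r) where
  open SymMonCat 𝕏
  field
    !₀ : Obj → Obj
    !₁ : ∀ {A B} → Hom A B → Hom (!₀ A) (!₀ B)
    !-resp-≈ : ∀ {A B} {f g : Hom A B} → f ≈ g → !₁ f ≈ !₁ g
    !-identity : ∀ {A} → !₁ (id {A}) ≈ id
    !-homomorphism : ∀ {A B C} {f : Hom A B} {g : Hom B C} → !₁ (g ∘ f) ≈ !₁ g ∘ !₁ f
    δ : ∀ {A} → Hom (!₀ A) (!₀ (!₀ A))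
    ε : ∀ {A} → Hom (!₀ A) A
    δ-natural : ∀ {A B} {f : Hom A B} → δ ∘ !₁ f ≈ !₁ (!₁ f) ∘ δ
    ε-natural : ∀ {A B} {f : Hom A B} → ε ∘ !₁ f ≈ f ∘ ε
    comonad-assoc : ∀ {A} → !₁ (δ {A}) ∘ δ ≈ δ ∘ δ
    comonad-idˡ : ∀ {A} → ε ∘ δ {A} ≈ id
    comonad-idʳ : ∀ {A} → !₁ (ε {A}) ∘ δ ≈ id
    m : ∀ {A B} → Hom (!₀ A ⊗₀ !₀ B) (!₀ (A ⊗₀ B))
    mK : Hom K (!₀ K)
    m-natural : ∀ {A A' B B'} {f : Hom A A'} {g : Hom B B'} →
                m ∘ (!₁ f ⊗₁ !₁ g) ≈ !₁ (f ⊗₁ g) ∘ m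
    m-assoc : ∀ {A B C} →
              m {A ⊗₀ B} {C} ∘ ((m ⊗₁ id) ∘ α)
              ≈ !₁ α ∘ (m {A} {B ⊗₀ C} ∘ (id ⊗₁ m))
    m-unitˡ : ∀ {A} → !₁ ℓ ∘ (m {K} {A} ∘ (mK ⊗₁ id)) ≈ ℓ
    m-unitʳ : ∀ {A} → !₁ ρ ∘ (m {A} {K} ∘ (id ⊗₁ mK)) ≈ ρ
    m-symmetric : ∀ {A B} → m {B} {A} ∘ σ ≈ !₁ σ ∘ m
    δ-m  : ∀ {A B} → δ ∘ m {A} {B} ≈ !₁ m ∘ (m ∘ (δ ⊗₁ δ))
    δ-mK : δ ∘ mK ≈ !₁ mK ∘ mK
    ε-m  : ∀ {A B} → ε ∘ m {A} {B} ≈ ε ⊗₁ ε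
    ε-mK : ε ∘ mK ≈ id
    Δ : ∀ {A} → Hom (!₀ A) (!₀ A ⊗₀ !₀ A)
    e : ∀ {A} → Hom (!₀ A) K
    Δ-natural : ∀ {A B} {f : Hom A B} → Δ ∘ !₁ f ≈ (!₁ f ⊗₁ !₁ f) ∘ Δ
    e-natural : ∀ {A B} {f : Hom A B} → e ∘ !₁ f ≈ e
    Δ-coassoc : ∀ {A} → (Δ ⊗₁ id) ∘ Δ {A} ≈ α ∘ ((id ⊗₁ Δ) ∘ Δ)
    Δ-counitˡ : ∀ {A} → ℓ ∘ ((e ⊗₁ id) ∘ Δ {A}) ≈ id
    Δ-counitʳ : ∀ {A} → ρ ∘ ((id ⊗₁ e) ∘ Δ {A}) ≈ id
    Δ-cocomm  : ∀ {A} → σ ∘ Δ {A} ≈ Δ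
    δ-Δ : ∀ {A} → Δ ∘ δ {A} ≈ (δ ⊗₁ δ) ∘ Δ
    δ-e : ∀ {A} → e ∘ δ {A} ≈ e
    Δ-m  : ∀ {A B} → Δ ∘ m {A} {B} ≈ (m ⊗₁ m) ∘ (τ ∘ (Δ ⊗₁ Δ))
    e-m  : ∀ {A B} → e ∘ m {A} {B} ≈ ℓ ∘ (e ⊗₁ e)
    Δ-mK : Δ ∘ mK ≈ (mK ⊗₁ mK) ∘ ℓ⁻¹
    e-mK : e ∘ mK ≈ id
    !Δ-δ : ∀ {A} → !₁ (Δ {A}) ∘ δ ≈ m ∘ ((δ ⊗₁ δ) ∘ Δ)
    !e-δ : ∀ {A} → !₁ (e {A}) ∘ δ ≈ mK ∘ e

record IsExponentialLiftingMonad {o h r} (𝕏 : SymMonCat o h r)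
    (M : MonoidalCoalgebraModality 𝕏)
    (T₀ : SymMonCat.Obj 𝕏 → SymMonCat.Obj 𝕏)
    (T₁ : ∀ {A B} → SymMonCat.Hom 𝕏 A B → SymMonCat.Hom 𝕏 (T₀ A) (T₀ B))
    (μ : ∀ {A} → SymMonCat.Hom 𝕏 (T₀ (T₀ A)) (T₀ A))
    (η : ∀ {A} → SymMonCat.Hom 𝕏 A (T₀ A))
    (n : ∀ {A B} → SymMonCat.Hom 𝕏 (T₀ (SymMonCat._⊗₀_ 𝕏 A B))
                                   (SymMonCat._⊗₀_ 𝕏 (T₀ A) (T₀ B)))
    (nK : SymMonCat.Hom 𝕏 (T₀ (SymMonCat.K 𝕏)) (SymMonCat.K 𝕏))
    (λ' : ∀ {B} → SymMonCat.Hom 𝕏 (T₀ (MonoidalCoalgebraModality.!₀ M B))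
                                   (MonoidalCoalgebraModality.!₀ M (T₀ B)))
    : Set (o ⊔ h ⊔ r) where
  open SymMonCat 𝕏
  open MonoidalCoalgebraModality M
  field
    T-resp-≈ : ∀ {A B} {f g : Hom A B} → f ≈ g → T₁ f ≈ T₁ g
    T-identity : ∀ {A} → T₁ (id {A}) ≈ id
    T-homomorphism : ∀ {A B C} {f : Hom A B} {g : Hom B C} → T₁ (g ∘ f) ≈ T₁ g ∘ T₁ f
    μ-natural : ∀ {A B} {f : Hom A B} → μ ∘ T₁ (T₁ f) ≈ T₁ f ∘ μ
    η-natural : ∀ {A B} {f : Hom A B} → η ∘ f ≈ T₁ f ∘ η
    monad-assoc : ∀ {A} → μ ∘ T₁ (μ {A}) ≈ μ ∘ μ
    monad-idˡ : ∀ {A} → μ ∘ T₁ (η {A}) ≈ id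
    monad-idʳ : ∀ {A} → μ ∘ η {T₀ A} ≈ id
    n-natural : ∀ {A A' B B'} {f : Hom A A'} {g : Hom B B'} →
                n ∘ T₁ (f ⊗₁ g) ≈ (T₁ f ⊗₁ T₁ g) ∘ n
    n-assoc : ∀ {A B C} →
              α ∘ ((id ⊗₁ n {B} {C}) ∘ n {A} {B ⊗₀ C})
              ≈ (n ⊗₁ id) ∘ (n {A ⊗₀ B} {C} ∘ T₁ α)
    n-unitˡ : ∀ {A} → ℓ ∘ ((nK ⊗₁ id) ∘ n {K} {A}) ≈ T₁ ℓ
    n-unitʳ : ∀ {A} → ρ ∘ ((id ⊗₁ nK) ∘ n {A} {K}) ≈ T₁ ρ
    n-symmetric : ∀ {A B} → σ ∘ n {A} {B} ≈ n ∘ T₁ σ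
    μ-n  : ∀ {A B} → n ∘ μ {A ⊗₀ B} ≈ (μ ⊗₁ μ) ∘ (n ∘ T₁ n)
    μ-nK : nK ∘ μ ≈ nK ∘ T₁ nK
    η-n  : ∀ {A B} → n ∘ η {A ⊗₀ B} ≈ η ⊗₁ η
    η-nK : nK ∘ η ≈ id
    λ-natural : ∀ {A B} {f : Hom A B} → λ' ∘ T₁ (!₁ f) ≈ !₁ (T₁ f) ∘ λ'
    λ-μ : ∀ {B} → λ' {B} ∘ μ ≈ !₁ μ ∘ (λ' ∘ T₁ λ')
    λ-η : ∀ {B} → λ' {B} ∘ η ≈ !₁ η
    λ-δ : ∀ {B} → δ ∘ λ' {B} ≈ !₁ λ' ∘ (λ' ∘ T₁ δ)
    λ-ε : ∀ {B} → ε ∘ λ' {B} ≈ T₁ ε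
    λ-m : ∀ {B C} → !₁ n ∘ (λ' {B ⊗₀ C} ∘ T₁ m) ≈ m ∘ ((λ' ⊗₁ λ') ∘ n)
    λ-mK : !₁ nK ∘ (λ' ∘ T₁ mK) ≈ mK ∘ nK

module Prop73Data {o h r} (𝕏 : SymMonCat o h r) (Ad : Additive 𝕏)
                  (M : MonoidalCoalgebraModality 𝕏) (A : SymMonCat.Obj 𝕏) where
  open SymMonCat 𝕏
  open Additive Ad
  open MonoidalCoalgebraModality M

  ∇ : Hom (!₀ A ⊗₀ !₀ A) (!₀ A)
  ∇ = !₁ (ρ ∘ (ε ⊗₁ e) + ℓ ∘ (e ⊗₁ ε)) ∘ (m { !₀ A} { !₀ A} ∘ (δ ⊗₁ δ))

  u : Hom K (!₀ A)
  u = !₁ (0h {K} {A}) ∘ mK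

  T₀ : Obj → Obj
  T₀ X = !₀ A ⊗₀ X

  T₁ : ∀ {X Y} → Hom X Y → Hom (T₀ X) (T₀ Y)
  T₁ f = id ⊗₁ f

  μT : ∀ {X} → Hom (T₀ (T₀ X)) (T₀ X)
  μT {X} = (∇ ⊗₁ id) ∘ α { !₀ A} { !₀ A} {X}

  ηT : ∀ {X} → Hom X (T₀ X)
  ηT {X} = (u ⊗₁ id) ∘ ℓ⁻¹ {X}

  nT : ∀ {X Y} → Hom (T₀ (X ⊗₀ Y)) (T₀ X ⊗₀ T₀ Y)
  nT {X} {Y} = τ { !₀ A} { !₀ A} {X} {Y} ∘ (Δ ⊗₁ id)

  nKT : Hom (T₀ K) K
  nKT = e ∘ ρ { !₀ A}

  λT : ∀ {X} → Hom (T₀ (!₀ X)) (!₀ (T₀ X))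
  λT {X} = m { !₀ A} {X} ∘ (δ ⊗₁ id)

-- The map ∇ is the promotion g ♯ = !g ∘ m ∘ (δ ⊗ δ) of g = ρ(ε ⊗ e) + ℓ(e ⊗ ε), and a promotion is
-- controlled by g alone: ε ∘ g ♯ = g, δ ∘ g ♯ = (g ♯) ♯ and e ∘ g ♯ = e ⊗ e.  Consequently both
-- sides of the associativity law for ∇ are promotions of maps into A, which agree by additivity:
-- each is the sum ε⊗e⊗e + e⊗ε⊗e + e⊗e⊗ε.  The unit laws reduce in the same way to ε ∘ u = 0 and
-- e ∘ u = 1, and the bimonoid laws follow from the compatibility of Δ and e with m and with δ.
-- The monad !A ⊗ − is then the one induced by the monoid (!A, ∇, u), its comonoidal structure is
-- induced by the comonoid (!A, Δ, e) through the interchange τ, and the laws for λ = m ∘ (δ ⊗ 1)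
-- come from the comonad laws of ! together with the monoidality of δ and the axioms relating Δ, e to δ.

module Submission where

open import Defs
open import Data.Product using (_×_; _,_)
open import Relation.Binary.Bundles using (Setoid)
import Relation.Binary.Reasoning.Setoid as SetoidReasoning

module CategoryReasoning {o h r} (𝕏 : SymMonCat o h r) where
  open SymMonCat 𝕏 public

  hom-setoid : Obj → Obj → Setoid h r
  hom-setoid A B = record { Carrier = Hom A B ; _≈_ = _≈_ ; isEquivalence = ≈-equiv }

  module _ {A B : Obj} where
    open Setoid (hom-setoid A B) public using (refl; sym; trans)
    open SetoidReasoning (hom-setoid A B) public

  infixr 4 _⟩∘⟨_ refl⟩∘⟨_ _⟩⊗⟨_
  infixl 5 _⟩∘⟨refl

  _⟩∘⟨_ : ∀ {A B C} {f f' : Hom B C} {g g' : Hom A B} → f ≈ f' → g ≈ g' → f ∘ g ≈ f' ∘ g'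
  _⟩∘⟨_ = ∘-resp-≈

  refl⟩∘⟨_ : ∀ {A B C} {f : Hom B C} {g g' : Hom A B} → g ≈ g' → f ∘ g ≈ f ∘ g'
  refl⟩∘⟨ p = ∘-resp-≈ refl p

  _⟩∘⟨refl : ∀ {A B C} {f f' : Hom B C} {g : Hom A B} → f ≈ f' → f ∘ g ≈ f' ∘ g
  p ⟩∘⟨refl = ∘-resp-≈ p refl

  _⟩⊗⟨_ : ∀ {A B C D} {f f' : Hom A B} {g g' : Hom C D} → f ≈ f' → g ≈ g' → f ⊗₁ g ≈ f' ⊗₁ g'
  _⟩⊗⟨_ = ⊗-resp-≈

  id⊗-resp : ∀ {A B C} {f g : Hom A B} → f ≈ g → id {C} ⊗₁ f ≈ id ⊗₁ g
  id⊗-resp p = refl ⟩⊗⟨ p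

  ⊗id-resp : ∀ {A B C} {f g : Hom A B} → f ≈ g → f ⊗₁ id {C} ≈ g ⊗₁ id
  ⊗id-resp p = p ⟩⊗⟨ refl

  sym-assoc : ∀ {A B C D} {f : Hom A B} {g : Hom B C} {k : Hom C D} → k ∘ (g ∘ f) ≈ (k ∘ g) ∘ f
  sym-assoc = sym assoc

  assoc² : ∀ {A B C D E} {a : Hom D E} {b : Hom C D} {c : Hom B C} {f : Hom A B} →
           (a ∘ (b ∘ c)) ∘ f ≈ a ∘ (b ∘ (c ∘ f))
  assoc² = trans assoc (refl⟩∘⟨ assoc)

  assoc³ : ∀ {A B C D E F} {a : Hom E F} {b : Hom D E} {c : Hom C D} {d : Hom B C} {f : Hom A B} →
           (a ∘ (b ∘ (c ∘ d))) ∘ f ≈ a ∘ (b ∘ (c ∘ (d ∘ f)))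
  assoc³ = trans assoc (refl⟩∘⟨ assoc²)

  assoc⁴ : ∀ {A B C D E F G} {a : Hom F G} {b : Hom E F} {c : Hom D E} {d : Hom C D} {e : Hom B C}
             {f : Hom A B} →
           (a ∘ (b ∘ (c ∘ (d ∘ e)))) ∘ f ≈ a ∘ (b ∘ (c ∘ (d ∘ (e ∘ f))))
  assoc⁴ = trans assoc (refl⟩∘⟨ assoc³)

  assoc⁵ : ∀ {A B C D E F G H} {a : Hom G H} {b : Hom F G} {c : Hom E F} {d : Hom D E} {e : Hom C D}
             {e' : Hom B C} {f : Hom A B} →
           (a ∘ (b ∘ (c ∘ (d ∘ (e ∘ e'))))) ∘ f ≈ a ∘ (b ∘ (c ∘ (d ∘ (e ∘ (e' ∘ f)))))
  assoc⁵ = trans assoc (refl⟩∘⟨ assoc⁴)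

  -- Rewrites the leading factors of a chain; L' and R' are L ∘ f and R ∘ f reassociated.
  reassoc-≈ : ∀ {A B C} {L R : Hom B C} {f : Hom A B} {L' R' : Hom A C} →
              L ∘ f ≈ L' → L ≈ R → R ∘ f ≈ R' → L' ≈ R'
  reassoc-≈ aL p aR = trans (sym aL) (trans (p ⟩∘⟨refl) aR)

  pullˡ : ∀ {A B C D} {a : Hom C D} {b : Hom B C} {c : Hom B D} {f : Hom A B} →
          a ∘ b ≈ c → a ∘ (b ∘ f) ≈ c ∘ f
  pullˡ p = trans sym-assoc (p ⟩∘⟨refl)

  pushˡ : ∀ {A B C D} {a : Hom C D} {b : Hom B C} {c : Hom B D} {f : Hom A B} →
          c ≈ a ∘ b → c ∘ f ≈ a ∘ (b ∘ f)
  pushˡ p = sym (pullˡ (sym p))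

  swapˡ : ∀ {A B C C' D} {a : Hom C D} {b : Hom B C} {c : Hom C' D} {d : Hom B C'} {f : Hom A B} →
          a ∘ b ≈ c ∘ d → a ∘ (b ∘ f) ≈ c ∘ (d ∘ f)
  swapˡ p = trans (pullˡ p) assoc

  cancelˡ : ∀ {A B C} {a : Hom B C} {b : Hom C B} {f : Hom A C} → a ∘ b ≈ id → a ∘ (b ∘ f) ≈ f
  cancelˡ p = trans (pullˡ p) identityˡ

  cancelʳ : ∀ {A B C} {a : Hom B A} {b : Hom A B} {f : Hom A C} → a ∘ b ≈ id → (f ∘ a) ∘ b ≈ f
  cancelʳ p = trans assoc (trans (refl⟩∘⟨ p) identityʳ)

  id-comm : ∀ {A B} {f : Hom A B} → id ∘ f ≈ f ∘ id
  id-comm = trans identityˡ (sym identityʳ)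

  switchʳ : ∀ {A B C} {i : Hom A B} {j : Hom B A} {f : Hom B C} {g : Hom A C} →
            i ∘ j ≈ id → f ∘ i ≈ g → f ≈ g ∘ j
  switchʳ {i = i} {j} {f} {g} ij p = begin
    f             ≈⟨ identityʳ ⟨
    f ∘ id        ≈⟨ refl⟩∘⟨ ij ⟨
    f ∘ (i ∘ j)   ≈⟨ pullˡ p ⟩
    g ∘ j         ∎

  switchˡ : ∀ {A B C} {i : Hom B C} {j : Hom C B} {f : Hom A B} {g : Hom A C} →
            j ∘ i ≈ id → i ∘ f ≈ g → f ≈ j ∘ g
  switchˡ {i = i} {j} {f} {g} ji p = begin
    f             ≈⟨ cancelˡ ji ⟨
    j ∘ (i ∘ f)   ≈⟨ refl⟩∘⟨ p ⟩
    j ∘ g         ∎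

  cancel-split-epi : ∀ {A B C} {i : Hom A B} {j : Hom B A} {f g : Hom B C} →
                     i ∘ j ≈ id → f ∘ i ≈ g ∘ i → f ≈ g
  cancel-split-epi ij p = trans (switchʳ ij p) (cancelʳ ij)

  cancel-split-mono : ∀ {A B C} {i : Hom B C} {j : Hom C B} {f g : Hom A B} →
                      j ∘ i ≈ id → i ∘ f ≈ i ∘ g → f ≈ g
  cancel-split-mono ji p = trans (switchˡ ji p) (cancelˡ ji)

  inverse-∘ : ∀ {A B C} {f : Hom B C} {f' : Hom C B} {g : Hom A B} {g' : Hom B A} {k : Hom A C}
                {k' : Hom C A} →
              f' ∘ f ≈ id → g' ∘ g ≈ id → k ∘ k' ≈ id → f ∘ g ≈ k → g' ∘ f' ≈ k'
  inverse-∘ {f = f} {f'} {g} {g'} {k} {k'} ff gg kk p = begin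
    g' ∘ f'                    ≈⟨ switchʳ kk refl ⟩
    ((g' ∘ f') ∘ k) ∘ k'       ≈⟨ (refl⟩∘⟨ p) ⟩∘⟨refl ⟨
    ((g' ∘ f') ∘ (f ∘ g)) ∘ k' ≈⟨ trans assoc (refl⟩∘⟨ cancelˡ ff) ⟩∘⟨refl ⟩
    (g' ∘ g) ∘ k'              ≈⟨ gg ⟩∘⟨refl ⟩
    id ∘ k'                    ≈⟨ identityˡ ⟩
    k'                         ∎

  inverse-square : ∀ {A B C D} {i : Hom A B} {i' : Hom B A} {j : Hom C D} {j' : Hom D C}
                     {a : Hom A C} {b : Hom B D} →
                   i ∘ i' ≈ id → j' ∘ j ≈ id → j ∘ a ≈ b ∘ i → j' ∘ b ≈ a ∘ i'
  inverse-square {i = i} {i'} {j} {j'} {a} {b} ii jj p = begin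
    j' ∘ b                 ≈⟨ identityʳ ⟨
    (j' ∘ b) ∘ id          ≈⟨ refl⟩∘⟨ ii ⟨
    (j' ∘ b) ∘ (i ∘ i')    ≈⟨ trans assoc (refl⟩∘⟨ sym-assoc) ⟩
    j' ∘ ((b ∘ i) ∘ i')    ≈⟨ refl⟩∘⟨ p ⟩∘⟨refl ⟨
    j' ∘ ((j ∘ a) ∘ i')    ≈⟨ refl⟩∘⟨ assoc ⟩
    j' ∘ (j ∘ (a ∘ i'))    ≈⟨ cancelˡ jj ⟩
    a ∘ i'                 ∎

  inverse-compose : ∀ {A B C} {y : Hom B C} {y' : Hom C B} {z : Hom A B} {z' : Hom B A} →
                    y' ∘ y ≈ id → z' ∘ z ≈ id → (z' ∘ y') ∘ (y ∘ z) ≈ id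
  inverse-compose yy zz = trans assoc (trans (refl⟩∘⟨ cancelˡ yy) zz)

  inverse-compose₃ : ∀ {A B C D} {u : Hom C D} {u' : Hom D C} {v : Hom B C} {v' : Hom C B}
                       {w : Hom A B} {w' : Hom B A} →
                     u ∘ u' ≈ id → v ∘ v' ≈ id → w ∘ w' ≈ id → (u ∘ (v ∘ w)) ∘ (w' ∘ (v' ∘ u')) ≈ id
  inverse-compose₃ uu vv ww =
    trans assoc² (trans (refl⟩∘⟨ refl⟩∘⟨ cancelˡ ww) (trans (refl⟩∘⟨ cancelˡ vv) uu))

  inverse-∘₃ : ∀ {A B C D B' C'} {x : Hom C D} {x' : Hom D C} {y : Hom B C} {y' : Hom C B}
                 {z : Hom A B} {z' : Hom B A} {u : Hom C' D} {u' : Hom D C'} {v : Hom B' C'}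
                 {v' : Hom C' B'} {w : Hom A B'} {w' : Hom B' A} →
               x' ∘ x ≈ id → y' ∘ y ≈ id → z' ∘ z ≈ id → u ∘ u' ≈ id → v ∘ v' ≈ id → w ∘ w' ≈ id →
               x ∘ (y ∘ z) ≈ u ∘ (v ∘ w) → z' ∘ (y' ∘ x') ≈ w' ∘ (v' ∘ u')
  inverse-∘₃ xx yy zz uu vv ww p =
    trans sym-assoc (inverse-∘ xx (inverse-compose yy zz) (inverse-compose₃ uu vv ww) p)

module MonoidalCoherence {o h r} (𝕏 : SymMonCat o h r) where
  open CategoryReasoning 𝕏 public

  ⊗-∘ : ∀ {A B C D E F} {f : Hom A B} {g : Hom B C} {k : Hom D E} {l : Hom E F} →
        (g ⊗₁ l) ∘ (f ⊗₁ k) ≈ (g ∘ f) ⊗₁ (l ∘ k)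
  ⊗-∘ = sym ⊗-homomorphism

  serialize₁₂ : ∀ {A B C D} {f : Hom A B} {g : Hom C D} → f ⊗₁ g ≈ (f ⊗₁ id) ∘ (id ⊗₁ g)
  serialize₁₂ = trans (sym identityʳ ⟩⊗⟨ sym identityˡ) ⊗-homomorphism

  serialize₂₁ : ∀ {A B C D} {f : Hom A B} {g : Hom C D} → f ⊗₁ g ≈ (id ⊗₁ g) ∘ (f ⊗₁ id)
  serialize₂₁ = trans (sym identityˡ ⟩⊗⟨ sym identityʳ) ⊗-homomorphism

  ⊗-swap : ∀ {A B C D} {f : Hom A B} {g : Hom C D} → (f ⊗₁ id) ∘ (id ⊗₁ g) ≈ (id ⊗₁ g) ∘ (f ⊗₁ id)
  ⊗-swap = trans (sym serialize₁₂) serialize₂₁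

  ⊗-factorˡ : ∀ {X Y Z U V} {x : Hom Y Z} {y : Hom X Y} {z : Hom U V} → (x ∘ y) ⊗₁ z ≈ (x ⊗₁ id) ∘ (y ⊗₁ z)
  ⊗-factorˡ = trans (refl ⟩⊗⟨ sym identityˡ) ⊗-homomorphism

  ⊗-factorʳ : ∀ {X Y Z U V} {x : Hom Y Z} {y : Hom X Y} {z : Hom U V} → z ⊗₁ (x ∘ y) ≈ (id ⊗₁ x) ∘ (z ⊗₁ y)
  ⊗-factorʳ = trans (sym identityˡ ⟩⊗⟨ refl) ⊗-homomorphism

  ⊗-square : ∀ {A B C D A' B' C' D'} {a : Hom B D} {b : Hom A B} {c : Hom C D} {d : Hom A C}
               {a' : Hom B' D'} {b' : Hom A' B'} {c' : Hom C' D'} {d' : Hom A' C'} →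
             a ∘ b ≈ c ∘ d → a' ∘ b' ≈ c' ∘ d' → (a ⊗₁ a') ∘ (b ⊗₁ b') ≈ (c ⊗₁ c') ∘ (d ⊗₁ d')
  ⊗-square p q = trans ⊗-∘ (trans (p ⟩⊗⟨ q) ⊗-homomorphism)

  ⊗-iso : ∀ {A B C D} {f : Hom A B} {f' : Hom B A} {g : Hom C D} {g' : Hom D C} →
          f' ∘ f ≈ id → g' ∘ g ≈ id → (f' ⊗₁ g') ∘ (f ⊗₁ g) ≈ id
  ⊗-iso p q = trans ⊗-∘ (trans (p ⟩⊗⟨ q) ⊗-identity)

  id⊗id-comm : ∀ {X Y Z} {f : Hom X (Y ⊗₀ Z)} → f ∘ id ≈ (id ⊗₁ id) ∘ f
  id⊗id-comm = trans identityʳ (sym (trans (⊗-identity ⟩∘⟨refl) identityˡ))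

  id⊗∘ : ∀ {A B C D} {f : Hom A B} {g : Hom B C} → (id {D} ⊗₁ g) ∘ (id ⊗₁ f) ≈ id ⊗₁ (g ∘ f)
  id⊗∘ = trans ⊗-∘ (identityˡ ⟩⊗⟨ refl)

  id⊗∘⁻ : ∀ {A B C D} {f : Hom A B} {g : Hom B C} → id {D} ⊗₁ (g ∘ f) ≈ (id ⊗₁ g) ∘ (id ⊗₁ f)
  id⊗∘⁻ = sym id⊗∘

  ∘⊗id : ∀ {A B C D} {f : Hom A B} {g : Hom B C} → (g ⊗₁ id {D}) ∘ (f ⊗₁ id) ≈ (g ∘ f) ⊗₁ id
  ∘⊗id = trans ⊗-∘ (refl ⟩⊗⟨ identityˡ)

  ∘⊗id⁻ : ∀ {A B C D} {f : Hom A B} {g : Hom B C} → (g ∘ f) ⊗₁ id {D} ≈ (g ⊗₁ id) ∘ (f ⊗₁ id)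
  ∘⊗id⁻ = sym ∘⊗id

  id⊗∘₃ : ∀ {A B C D X} {p : Hom C D} {q : Hom B C} {r : Hom A B} →
          (id {X} ⊗₁ p) ∘ ((id ⊗₁ q) ∘ (id ⊗₁ r)) ≈ id ⊗₁ (p ∘ (q ∘ r))
  id⊗∘₃ = trans (refl⟩∘⟨ id⊗∘) id⊗∘

  id⊗∘⁻₃ : ∀ {A B C D X} {p : Hom C D} {q : Hom B C} {r : Hom A B} →
           id {X} ⊗₁ (p ∘ (q ∘ r)) ≈ (id ⊗₁ p) ∘ ((id ⊗₁ q) ∘ (id ⊗₁ r))
  id⊗∘⁻₃ = sym id⊗∘₃

  id⊗∘₄ : ∀ {A B C D E X} {p : Hom D E} {q : Hom C D} {r : Hom B C} {s : Hom A B} →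
          (id {X} ⊗₁ p) ∘ ((id ⊗₁ q) ∘ ((id ⊗₁ r) ∘ (id ⊗₁ s))) ≈ id ⊗₁ (p ∘ (q ∘ (r ∘ s)))
  id⊗∘₄ = trans (refl⟩∘⟨ id⊗∘₃) id⊗∘

  id⊗∘₅ : ∀ {A B C D E F X} {p : Hom E F} {q : Hom D E} {r : Hom C D} {s : Hom B C} {t : Hom A B} →
          (id {X} ⊗₁ p) ∘ ((id ⊗₁ q) ∘ ((id ⊗₁ r) ∘ ((id ⊗₁ s) ∘ (id ⊗₁ t))))
          ≈ id ⊗₁ (p ∘ (q ∘ (r ∘ (s ∘ t))))
  id⊗∘₅ = trans (refl⟩∘⟨ id⊗∘₄) id⊗∘

  id⊗∘₆ : ∀ {A B C D E F G X} {p : Hom F G} {q : Hom E F} {r : Hom D E} {s : Hom C D} {t : Hom B C}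
            {u : Hom A B} →
          (id {X} ⊗₁ p) ∘ ((id ⊗₁ q) ∘ ((id ⊗₁ r) ∘ ((id ⊗₁ s) ∘ ((id ⊗₁ t) ∘ (id ⊗₁ u)))))
          ≈ id ⊗₁ (p ∘ (q ∘ (r ∘ (s ∘ (t ∘ u)))))
  id⊗∘₆ = trans (refl⟩∘⟨ id⊗∘₅) id⊗∘

  ∘⊗id⁻₃ : ∀ {A B C D X} {p : Hom C D} {q : Hom B C} {r : Hom A B} →
           (p ∘ (q ∘ r)) ⊗₁ id {X} ≈ (p ⊗₁ id) ∘ ((q ⊗₁ id) ∘ (r ⊗₁ id))
  ∘⊗id⁻₃ = trans ∘⊗id⁻ (refl⟩∘⟨ ∘⊗id⁻)

  ∘⊗id⁻₅ : ∀ {A B C D E F X} {p : Hom E F} {q : Hom D E} {r : Hom C D} {s : Hom B C} {t : Hom A B} →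
           (p ∘ (q ∘ (r ∘ (s ∘ t)))) ⊗₁ id {X}
           ≈ (p ⊗₁ id) ∘ ((q ⊗₁ id) ∘ ((r ⊗₁ id) ∘ ((s ⊗₁ id) ∘ (t ⊗₁ id))))
  ∘⊗id⁻₅ = trans ∘⊗id⁻ (refl⟩∘⟨ trans ∘⊗id⁻ (refl⟩∘⟨ ∘⊗id⁻₃))

  α⁻¹-natural : ∀ {A A' B B' C C'} {f : Hom A A'} {g : Hom B B'} {k : Hom C C'} →
                α⁻¹ ∘ ((f ⊗₁ g) ⊗₁ k) ≈ (f ⊗₁ (g ⊗₁ k)) ∘ α⁻¹
  α⁻¹-natural = inverse-square α-isoʳ α-isoˡ α-natural

  ℓ⁻¹-natural : ∀ {A B} {f : Hom A B} → ℓ⁻¹ ∘ f ≈ (id ⊗₁ f) ∘ ℓ⁻¹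
  ℓ⁻¹-natural = inverse-square ℓ-isoʳ ℓ-isoˡ ℓ-natural

  α-natural₁ : ∀ {A A' B C} {f : Hom A A'} → α ∘ (f ⊗₁ id {B ⊗₀ C}) ≈ ((f ⊗₁ id) ⊗₁ id) ∘ α
  α-natural₁ = trans (refl⟩∘⟨ (refl ⟩⊗⟨ sym ⊗-identity)) α-natural

  α-natural₃ : ∀ {A B C C'} {f : Hom C C'} → α ∘ (id {A} ⊗₁ (id {B} ⊗₁ f)) ≈ (id ⊗₁ f) ∘ α
  α-natural₃ = trans α-natural ((⊗-identity ⟩⊗⟨ refl) ⟩∘⟨refl)

  α⁻¹-natural₃ : ∀ {A B C C'} {f : Hom C C'} → α⁻¹ ∘ (id {A ⊗₀ B} ⊗₁ f) ≈ (id ⊗₁ (id ⊗₁ f)) ∘ α⁻¹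
  α⁻¹-natural₃ = trans (refl⟩∘⟨ (sym ⊗-identity ⟩⊗⟨ refl)) α⁻¹-natural

  α-iso⊗ʳ : ∀ {A B C D} → (id {D} ⊗₁ α {A} {B} {C}) ∘ (id ⊗₁ α⁻¹) ≈ id
  α-iso⊗ʳ = ⊗-iso identityˡ α-isoʳ

  α-iso⊗ˡ : ∀ {A B C D} → (id {D} ⊗₁ α⁻¹ {A} {B} {C}) ∘ (id ⊗₁ α) ≈ id
  α-iso⊗ˡ = ⊗-iso identityˡ α-isoˡ

  cancel-K⊗ : ∀ {A B} {f g : Hom A B} → id {K} ⊗₁ f ≈ id ⊗₁ g → f ≈ g
  cancel-K⊗ {f = f} {g} p = cancel-split-epi ℓ-isoʳ (begin
    f ∘ ℓ          ≈⟨ ℓ-natural ⟨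
    ℓ ∘ (id ⊗₁ f)  ≈⟨ refl⟩∘⟨ p ⟩
    ℓ ∘ (id ⊗₁ g)  ≈⟨ ℓ-natural ⟩
    g ∘ ℓ          ∎)

  cancel-⊗K : ∀ {A B} {f g : Hom A B} → f ⊗₁ id {K} ≈ g ⊗₁ id → f ≈ g
  cancel-⊗K {f = f} {g} p = cancel-split-epi ρ-isoʳ (begin
    f ∘ ρ          ≈⟨ ρ-natural ⟨
    ρ ∘ (f ⊗₁ id)  ≈⟨ refl⟩∘⟨ p ⟩
    ρ ∘ (g ⊗₁ id)  ≈⟨ ρ-natural ⟩
    g ∘ ρ          ∎)

  kellyˡ : ∀ {B C} → (ℓ {B} ⊗₁ id {C}) ∘ α ≈ ℓ
  kellyˡ = sym (cancel-K⊗ (cancel-split-mono α-isoˡ (begin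
    α ∘ (id ⊗₁ ℓ)                                       ≈⟨ refl⟩∘⟨ triangle ⟨
    α ∘ ((ρ ⊗₁ id) ∘ α)                                 ≈⟨ refl⟩∘⟨ (refl ⟩⊗⟨ ⊗-identity) ⟩∘⟨refl ⟨
    α ∘ ((ρ ⊗₁ (id ⊗₁ id)) ∘ α)                         ≈⟨ trans (pullˡ α-natural) assoc ⟩
    ((ρ ⊗₁ id) ⊗₁ id) ∘ (α ∘ α)                         ≈⟨ refl⟩∘⟨ pentagon ⟩
    ((ρ ⊗₁ id) ⊗₁ id) ∘ ((α ⊗₁ id) ∘ (α ∘ (id ⊗₁ α)))   ≈⟨ pullˡ ∘⊗id ⟩
    (((ρ ⊗₁ id) ∘ α) ⊗₁ id) ∘ (α ∘ (id ⊗₁ α))           ≈⟨ ⊗id-resp triangle ⟩∘⟨refl ⟩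
    ((id ⊗₁ ℓ) ⊗₁ id) ∘ (α ∘ (id ⊗₁ α))                 ≈⟨ swapˡ α-natural ⟨
    α ∘ ((id ⊗₁ (ℓ ⊗₁ id)) ∘ (id ⊗₁ α))                 ≈⟨ refl⟩∘⟨ id⊗∘ ⟩
    α ∘ (id ⊗₁ ((ℓ ⊗₁ id) ∘ α))                         ∎)))

  kellyʳ : ∀ {A B} → ρ {A ⊗₀ B} ∘ α ≈ id ⊗₁ ρ
  kellyʳ = cancel-⊗K (cancel-split-epi α-isoʳ (cancel-split-epi α-iso⊗ʳ (begin
    (((ρ ∘ α) ⊗₁ id) ∘ α) ∘ (id ⊗₁ α)                   ≈⟨ assoc ⟩
    ((ρ ∘ α) ⊗₁ id) ∘ (α ∘ (id ⊗₁ α))                   ≈⟨ trans (∘⊗id⁻ ⟩∘⟨refl) assoc ⟩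
    (ρ ⊗₁ id) ∘ ((α ⊗₁ id) ∘ (α ∘ (id ⊗₁ α)))           ≈⟨ refl⟩∘⟨ pentagon ⟨
    (ρ ⊗₁ id) ∘ (α ∘ α)                                 ≈⟨ pullˡ triangle ⟩
    (id ⊗₁ ℓ) ∘ α                                       ≈⟨ (⊗-identity ⟩⊗⟨ refl) ⟩∘⟨refl ⟨
    ((id ⊗₁ id) ⊗₁ ℓ) ∘ α                               ≈⟨ α-natural ⟨
    α ∘ (id ⊗₁ (id ⊗₁ ℓ))                               ≈⟨ refl⟩∘⟨ id⊗-resp triangle ⟨
    α ∘ (id ⊗₁ ((ρ ⊗₁ id) ∘ α))                         ≈⟨ refl⟩∘⟨ id⊗∘ ⟨
    α ∘ ((id ⊗₁ (ρ ⊗₁ id)) ∘ (id ⊗₁ α))                 ≈⟨ pullˡ α-natural ⟩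
    (((id ⊗₁ ρ) ⊗₁ id) ∘ α) ∘ (id ⊗₁ α)                 ∎)))

  ℓ-K⊗ : ∀ {A} → ℓ {K ⊗₀ A} ≈ id ⊗₁ ℓ
  ℓ-K⊗ = cancel-split-mono ℓ-isoˡ (sym ℓ-natural)

  ℓK≈ρK : ℓ {K} ≈ ρ
  ℓK≈ρK = cancel-⊗K (cancel-split-epi α-isoʳ (begin
    (ℓ ⊗₁ id) ∘ α   ≈⟨ kellyˡ ⟩
    ℓ               ≈⟨ ℓ-K⊗ ⟩
    id ⊗₁ ℓ         ≈⟨ triangle ⟨
    (ρ ⊗₁ id) ∘ α   ∎))

  ℓ∘α⁻¹ : ∀ {B C} → ℓ ∘ α⁻¹ ≈ ℓ {B} ⊗₁ id {C}
  ℓ∘α⁻¹ = sym (switchʳ α-isoʳ kellyˡ)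

  id⊗ℓ∘α⁻¹ : ∀ {A B} → (id {A} ⊗₁ ℓ {B}) ∘ α⁻¹ ≈ ρ ⊗₁ id
  id⊗ℓ∘α⁻¹ = sym (switchʳ α-isoʳ triangle)

  α⁻¹∘ρ⁻¹⊗id : ∀ {A B} → α⁻¹ ∘ (ρ⁻¹ {A} ⊗₁ id {B}) ≈ id ⊗₁ ℓ⁻¹
  α⁻¹∘ρ⁻¹⊗id = inverse-∘ (⊗-iso ρ-isoˡ identityˡ) α-isoˡ (⊗-iso identityˡ ℓ-isoʳ) triangle

  α⁻¹∘ℓ⁻¹⊗id : ∀ {B C} → α⁻¹ ∘ (ℓ⁻¹ {B} ⊗₁ id {C}) ≈ ℓ⁻¹
  α⁻¹∘ℓ⁻¹⊗id = inverse-∘ (⊗-iso ℓ-isoˡ identityˡ) α-isoˡ ℓ-isoʳ kellyˡ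

  α∘ℓ⁻¹ : ∀ {B C} → α ∘ ℓ⁻¹ ≈ ℓ⁻¹ {B} ⊗₁ id {C}
  α∘ℓ⁻¹ = inverse-∘ ℓ-isoˡ α-isoʳ (⊗-iso ℓ-isoʳ identityˡ) ℓ∘α⁻¹

  α⊗id∘α : ∀ {A B C D} → (α {A} {B} {C} ⊗₁ id {D}) ∘ α ≈ α ∘ (α ∘ (id ⊗₁ α⁻¹))
  α⊗id∘α = trans (switchʳ α-iso⊗ʳ (trans assoc (sym pentagon))) assoc

  α⁻¹⊗id∘α : ∀ {A B C D} → (α⁻¹ {A} {B} {C} ⊗₁ id {D}) ∘ α ≈ α ∘ ((id ⊗₁ α) ∘ α⁻¹)
  α⁻¹⊗id∘α = sym (switchˡ (⊗-iso α-isoˡ identityˡ) (sym (trans (switchʳ α-isoʳ pentagon) assoc²)))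

  α⁻¹∘α⊗id∘α : ∀ {A B C D} → α⁻¹ ∘ ((α {A} {B} {C} ⊗₁ id {D}) ∘ α) ≈ α ∘ (id ⊗₁ α⁻¹)
  α⁻¹∘α⊗id∘α = sym (switchˡ α-isoˡ (sym α⊗id∘α))

  α⊗id∘α∘id⊗α∘α⁻¹ : ∀ {A B C D} → (α {A} {B} {C} ⊗₁ id {D}) ∘ (α ∘ ((id ⊗₁ α) ∘ α⁻¹)) ≈ α
  α⊗id∘α∘id⊗α∘α⁻¹ = trans (reassoc-≈ assoc² (sym pentagon) assoc) (trans (refl⟩∘⟨ α-isoʳ) identityʳ)

  pentagon⁻¹ : ∀ {A B C D} → α⁻¹ {A} {B} {C ⊗₀ D} ∘ α⁻¹ ≈ (id ⊗₁ α⁻¹) ∘ (α⁻¹ ∘ (α⁻¹ ⊗₁ id))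
  pentagon⁻¹ = inverse-∘ α-isoˡ α-isoˡ
                 (inverse-compose₃ (⊗-iso α-isoʳ identityˡ) α-isoʳ (⊗-iso identityˡ α-isoʳ)) pentagon

  ℓ∘σ : ∀ {A} → ℓ ∘ σ {A} {K} ≈ ρ
  ℓ∘σ = sym (cancel-⊗K (cancel-split-mono σ-involutive (begin
    σ ∘ (ρ ⊗₁ id)                        ≈⟨ refl⟩∘⟨ id⊗ℓ∘α⁻¹ ⟨
    σ ∘ ((id ⊗₁ ℓ) ∘ α⁻¹)                ≈⟨ swapˡ σ-natural ⟩
    (ℓ ⊗₁ id) ∘ (σ ∘ α⁻¹)                ≈⟨ pullˡ ℓ∘α⁻¹ ⟨
    ℓ ∘ (α⁻¹ ∘ (σ ∘ α⁻¹))                ≈⟨ refl⟩∘⟨ hexagon ⟩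
    ℓ ∘ ((id ⊗₁ σ) ∘ (α⁻¹ ∘ (σ ⊗₁ id)))  ≈⟨ trans (pullˡ ℓ-natural) assoc ⟩
    σ ∘ (ℓ ∘ (α⁻¹ ∘ (σ ⊗₁ id)))          ≈⟨ refl⟩∘⟨ pullˡ ℓ∘α⁻¹ ⟩
    σ ∘ ((ℓ ⊗₁ id) ∘ (σ ⊗₁ id))          ≈⟨ refl⟩∘⟨ ∘⊗id ⟩
    σ ∘ ((ℓ ∘ σ) ⊗₁ id)                  ∎)))

  ρ∘σ : ∀ {A} → ρ ∘ σ {K} {A} ≈ ℓ
  ρ∘σ = trans (sym ℓ∘σ ⟩∘⟨refl) (cancelʳ σ-involutive)

  σK≈ρ⁻¹∘ℓ : ∀ {X} → σ {K} {X} ≈ ρ⁻¹ ∘ ℓ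
  σK≈ρ⁻¹∘ℓ = switchˡ ρ-isoˡ ρ∘σ

  hexagon′ : ∀ {A B C} → α {A} {B} {C} ∘ (σ ∘ α) ≈ (σ ⊗₁ id) ∘ (α ∘ (id ⊗₁ σ))
  hexagon′ = inverse-∘₃ α-isoʳ σ-involutive α-isoʳ (⊗-iso identityˡ σ-involutive) α-isoˡ
               (⊗-iso σ-involutive identityˡ) hexagon

  σ-⊗ʳ : ∀ {B C C'} → σ {B} {C ⊗₀ C'} ≈ α ∘ ((id ⊗₁ σ) ∘ (α⁻¹ ∘ ((σ ⊗₁ id) ∘ α)))
  σ-⊗ʳ = trans (switchʳ α-isoˡ (switchˡ α-isoʳ hexagon)) assoc³

  σ-⊗ˡ : ∀ {B B' C} → σ {B ⊗₀ B'} {C} ≈ α⁻¹ ∘ ((σ ⊗₁ id) ∘ (α ∘ ((id ⊗₁ σ) ∘ α⁻¹)))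
  σ-⊗ˡ = trans (switchʳ α-isoʳ (switchˡ α-isoˡ hexagon′)) assoc³

module Interchange {o h r} (𝕏 : SymMonCat o h r) where
  open MonoidalCoherence 𝕏 public

  -- τ unfolds to α ∘ (id ⊗ θ) ∘ α⁻¹, so its coherences are derived from those of θ.
  θ : ∀ {B C D} → Hom (B ⊗₀ (C ⊗₀ D)) (C ⊗₀ (B ⊗₀ D))
  θ {B} {C} {D} = α⁻¹ {C} {B} {D} ∘ ((σ {B} {C} ⊗₁ id {D}) ∘ α {B} {C} {D})

  θ-natural : ∀ {B B' C C' D D'} {f : Hom B B'} {g : Hom C C'} {k : Hom D D'} →
              θ ∘ (f ⊗₁ (g ⊗₁ k)) ≈ (g ⊗₁ (f ⊗₁ k)) ∘ θ
  θ-natural = trans assoc² (trans (refl⟩∘⟨ refl⟩∘⟨ α-natural)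
                (trans (refl⟩∘⟨ swapˡ (⊗-square σ-natural id-comm)) (swapˡ α⁻¹-natural)))

  τ-natural : ∀ {A A' B B' C C' D D'} {f : Hom A A'} {g : Hom B B'} {k : Hom C C'} {l : Hom D D'} →
              τ ∘ ((f ⊗₁ g) ⊗₁ (k ⊗₁ l)) ≈ ((f ⊗₁ k) ⊗₁ (g ⊗₁ l)) ∘ τ
  τ-natural = trans assoc² (trans (refl⟩∘⟨ refl⟩∘⟨ α⁻¹-natural)
                (trans (refl⟩∘⟨ swapˡ (⊗-square id-comm θ-natural)) (swapˡ α-natural)))

  τ-natural₁ : ∀ {X X' Y Z W} {g : Hom X X'} → ((g ⊗₁ id) ⊗₁ id) ∘ τ {X} {Y} {Z} {W} ≈ τ ∘ ((g ⊗₁ id) ⊗₁ id)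
  τ-natural₁ = trans ((refl ⟩⊗⟨ sym ⊗-identity) ⟩∘⟨refl) (trans (sym τ-natural) (refl⟩∘⟨ (refl ⟩⊗⟨ ⊗-identity)))

  τ-natural₂ : ∀ {X Y Y' Z W} {g : Hom Y Y'} → (id ⊗₁ (g ⊗₁ id)) ∘ τ {X} {Y} {Z} {W} ≈ τ ∘ ((id ⊗₁ g) ⊗₁ id)
  τ-natural₂ = trans ((sym ⊗-identity ⟩⊗⟨ refl) ⟩∘⟨refl) (trans (sym τ-natural) (refl⟩∘⟨ (refl ⟩⊗⟨ ⊗-identity)))

  θ-⊗₂ : ∀ {B C C' D} → θ {B} {C ⊗₀ C'} {D} ≈ α ∘ ((id ⊗₁ θ) ∘ (θ ∘ (id ⊗₁ α⁻¹)))
  θ-⊗₂ = begin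
    α⁻¹ ∘ ((σ ⊗₁ id) ∘ α)
      ≈⟨ refl⟩∘⟨ (trans (⊗id-resp σ-⊗ʳ) ∘⊗id⁻₅) ⟩∘⟨refl ⟩
    α⁻¹ ∘ (((α ⊗₁ id) ∘ (((id ⊗₁ σ) ⊗₁ id) ∘ ((α⁻¹ ⊗₁ id) ∘ (((σ ⊗₁ id) ⊗₁ id) ∘ (α ⊗₁ id))))) ∘ α)
      ≈⟨ refl⟩∘⟨ assoc⁴ ⟩
    α⁻¹ ∘ ((α ⊗₁ id) ∘ (((id ⊗₁ σ) ⊗₁ id) ∘ ((α⁻¹ ⊗₁ id) ∘ (((σ ⊗₁ id) ⊗₁ id) ∘ ((α ⊗₁ id) ∘ α)))))
      ≈⟨ refl⟩∘⟨ refl⟩∘⟨ refl⟩∘⟨ refl⟩∘⟨ refl⟩∘⟨ α⊗id∘α ⟩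
    α⁻¹ ∘ ((α ⊗₁ id) ∘ (((id ⊗₁ σ) ⊗₁ id) ∘ ((α⁻¹ ⊗₁ id) ∘ (((σ ⊗₁ id) ⊗₁ id) ∘ (α ∘ (α ∘ (id ⊗₁ α⁻¹)))))))
      ≈⟨ refl⟩∘⟨ refl⟩∘⟨ refl⟩∘⟨ refl⟩∘⟨ swapˡ α-natural₁ ⟨
    α⁻¹ ∘ ((α ⊗₁ id) ∘ (((id ⊗₁ σ) ⊗₁ id) ∘ ((α⁻¹ ⊗₁ id) ∘ (α ∘ ((σ ⊗₁ id) ∘ (α ∘ (id ⊗₁ α⁻¹)))))))
      ≈⟨ refl⟩∘⟨ refl⟩∘⟨ refl⟩∘⟨ reassoc-≈ assoc α⁻¹⊗id∘α assoc² ⟩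
    α⁻¹ ∘ ((α ⊗₁ id) ∘ (((id ⊗₁ σ) ⊗₁ id) ∘ (α ∘ ((id ⊗₁ α) ∘ (α⁻¹ ∘ ((σ ⊗₁ id) ∘ (α ∘ (id ⊗₁ α⁻¹))))))))
      ≈⟨ refl⟩∘⟨ refl⟩∘⟨ swapˡ α-natural ⟨
    α⁻¹ ∘ ((α ⊗₁ id) ∘ (α ∘ ((id ⊗₁ (σ ⊗₁ id)) ∘ ((id ⊗₁ α) ∘ (α⁻¹ ∘ ((σ ⊗₁ id) ∘ (α ∘ (id ⊗₁ α⁻¹))))))))
      ≈⟨ reassoc-≈ assoc² α⁻¹∘α⊗id∘α assoc ⟩
    α ∘ ((id ⊗₁ α⁻¹) ∘ ((id ⊗₁ (σ ⊗₁ id)) ∘ ((id ⊗₁ α) ∘ (α⁻¹ ∘ ((σ ⊗₁ id) ∘ (α ∘ (id ⊗₁ α⁻¹)))))))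
      ≈⟨ refl⟩∘⟨ reassoc-≈ assoc² id⊗∘₃ refl ⟩
    α ∘ ((id ⊗₁ θ) ∘ (α⁻¹ ∘ ((σ ⊗₁ id) ∘ (α ∘ (id ⊗₁ α⁻¹)))))
      ≈⟨ refl⟩∘⟨ refl⟩∘⟨ assoc² ⟨
    α ∘ ((id ⊗₁ θ) ∘ (θ ∘ (id ⊗₁ α⁻¹))) ∎

  θ-⊗₁ : ∀ {B B' C D} → θ {B ⊗₀ B'} {C} {D} ≈ (id ⊗₁ α) ∘ (θ ∘ ((id ⊗₁ θ) ∘ α⁻¹))
  θ-⊗₁ = begin
    α⁻¹ ∘ ((σ ⊗₁ id) ∘ α)
      ≈⟨ refl⟩∘⟨ (trans (⊗id-resp σ-⊗ˡ) ∘⊗id⁻₅) ⟩∘⟨refl ⟩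
    α⁻¹ ∘ (((α⁻¹ ⊗₁ id) ∘ (((σ ⊗₁ id) ⊗₁ id) ∘ ((α ⊗₁ id) ∘ (((id ⊗₁ σ) ⊗₁ id) ∘ (α⁻¹ ⊗₁ id))))) ∘ α)
      ≈⟨ refl⟩∘⟨ assoc⁴ ⟩
    α⁻¹ ∘ ((α⁻¹ ⊗₁ id) ∘ (((σ ⊗₁ id) ⊗₁ id) ∘ ((α ⊗₁ id) ∘ (((id ⊗₁ σ) ⊗₁ id) ∘ ((α⁻¹ ⊗₁ id) ∘ α)))))
      ≈⟨ refl⟩∘⟨ refl⟩∘⟨ refl⟩∘⟨ refl⟩∘⟨ refl⟩∘⟨ α⁻¹⊗id∘α ⟩
    α⁻¹ ∘ ((α⁻¹ ⊗₁ id) ∘ (((σ ⊗₁ id) ⊗₁ id) ∘ ((α ⊗₁ id) ∘ (((id ⊗₁ σ) ⊗₁ id) ∘ (α ∘ ((id ⊗₁ α) ∘ α⁻¹))))))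
      ≈⟨ refl⟩∘⟨ refl⟩∘⟨ refl⟩∘⟨ refl⟩∘⟨ swapˡ α-natural ⟨
    α⁻¹ ∘ ((α⁻¹ ⊗₁ id) ∘ (((σ ⊗₁ id) ⊗₁ id) ∘ ((α ⊗₁ id) ∘ (α ∘ ((id ⊗₁ (σ ⊗₁ id)) ∘ ((id ⊗₁ α) ∘ α⁻¹))))))
      ≈⟨ refl⟩∘⟨ refl⟩∘⟨ refl⟩∘⟨ reassoc-≈ assoc α⊗id∘α assoc² ⟩
    α⁻¹ ∘ ((α⁻¹ ⊗₁ id) ∘ (((σ ⊗₁ id) ⊗₁ id) ∘ (α ∘ (α ∘ ((id ⊗₁ α⁻¹) ∘ ((id ⊗₁ (σ ⊗₁ id)) ∘ ((id ⊗₁ α) ∘ α⁻¹)))))))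
      ≈⟨ refl⟩∘⟨ refl⟩∘⟨ swapˡ α-natural₁ ⟨
    α⁻¹ ∘ ((α⁻¹ ⊗₁ id) ∘ (α ∘ ((σ ⊗₁ id) ∘ (α ∘ ((id ⊗₁ α⁻¹) ∘ ((id ⊗₁ (σ ⊗₁ id)) ∘ ((id ⊗₁ α) ∘ α⁻¹)))))))
      ≈⟨ refl⟩∘⟨ reassoc-≈ assoc α⁻¹⊗id∘α assoc² ⟩
    α⁻¹ ∘ (α ∘ ((id ⊗₁ α) ∘ (α⁻¹ ∘ ((σ ⊗₁ id) ∘ (α ∘ ((id ⊗₁ α⁻¹) ∘ ((id ⊗₁ (σ ⊗₁ id)) ∘ ((id ⊗₁ α) ∘ α⁻¹))))))))
      ≈⟨ cancelˡ α-isoˡ ⟩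
    (id ⊗₁ α) ∘ (α⁻¹ ∘ ((σ ⊗₁ id) ∘ (α ∘ ((id ⊗₁ α⁻¹) ∘ ((id ⊗₁ (σ ⊗₁ id)) ∘ ((id ⊗₁ α) ∘ α⁻¹))))))
      ≈⟨ refl⟩∘⟨ refl⟩∘⟨ refl⟩∘⟨ refl⟩∘⟨ reassoc-≈ assoc² id⊗∘₃ refl ⟩
    (id ⊗₁ α) ∘ (α⁻¹ ∘ ((σ ⊗₁ id) ∘ (α ∘ ((id ⊗₁ θ) ∘ α⁻¹))))
      ≈⟨ refl⟩∘⟨ assoc² ⟨
    (id ⊗₁ α) ∘ (θ ∘ ((id ⊗₁ θ) ∘ α⁻¹)) ∎

  id⊗α∘θ : ∀ {B C D Y} → (id ⊗₁ α) ∘ θ {B} {C} {D ⊗₀ Y} ≈ α⁻¹ ∘ ((θ ⊗₁ id) ∘ (α ∘ (id ⊗₁ α)))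
  id⊗α∘θ = begin
    (id ⊗₁ α) ∘ (α⁻¹ ∘ ((σ ⊗₁ id) ∘ α))
      ≈⟨ trans (refl⟩∘⟨ reassoc-≈ assoc α⁻¹⊗id∘α assoc²) (cancelˡ α-isoˡ) ⟨
    α⁻¹ ∘ ((α⁻¹ ⊗₁ id) ∘ (α ∘ ((σ ⊗₁ id) ∘ α)))
      ≈⟨ refl⟩∘⟨ refl⟩∘⟨ swapˡ α-natural₁ ⟩
    α⁻¹ ∘ ((α⁻¹ ⊗₁ id) ∘ (((σ ⊗₁ id) ⊗₁ id) ∘ (α ∘ α)))
      ≈⟨ refl⟩∘⟨ refl⟩∘⟨ refl⟩∘⟨ pentagon ⟩
    α⁻¹ ∘ ((α⁻¹ ⊗₁ id) ∘ (((σ ⊗₁ id) ⊗₁ id) ∘ ((α ⊗₁ id) ∘ (α ∘ (id ⊗₁ α)))))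
      ≈⟨ refl⟩∘⟨ reassoc-≈ refl ∘⊗id⁻₃ assoc² ⟨
    α⁻¹ ∘ ((θ ⊗₁ id) ∘ (α ∘ (id ⊗₁ α))) ∎

  θ∘id⊗α : ∀ {C D E F} → θ {C} {D ⊗₀ E} {F} ∘ (id ⊗₁ α) ≈ α ∘ ((id ⊗₁ θ) ∘ θ)
  θ∘id⊗α = trans (θ-⊗₂ ⟩∘⟨refl) (trans assoc² (refl⟩∘⟨ refl⟩∘⟨ cancelʳ α-iso⊗ˡ))

  τ∘α : ∀ {B C E F} → τ {B} {C} {E} {F} ∘ α ≈ α ∘ (id ⊗₁ θ)
  τ∘α = trans assoc² (refl⟩∘⟨ trans (refl⟩∘⟨ α-isoˡ) identityʳ)

  θ∘id⊗α⁻¹ : ∀ {B C D Y} → θ {B} {C} {D ⊗₀ Y} ∘ (id ⊗₁ α⁻¹) ≈ (id ⊗₁ α⁻¹) ∘ (α⁻¹ ∘ ((θ ⊗₁ id) ∘ α))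
  θ∘id⊗α⁻¹ = begin
    θ ∘ (id ⊗₁ α⁻¹)
      ≈⟨ switchˡ α-iso⊗ˡ id⊗α∘θ ⟩∘⟨refl ⟩
    ((id ⊗₁ α⁻¹) ∘ (α⁻¹ ∘ ((θ ⊗₁ id) ∘ (α ∘ (id ⊗₁ α))))) ∘ (id ⊗₁ α⁻¹)
      ≈⟨ assoc⁴ ⟩
    (id ⊗₁ α⁻¹) ∘ (α⁻¹ ∘ ((θ ⊗₁ id) ∘ (α ∘ ((id ⊗₁ α) ∘ (id ⊗₁ α⁻¹)))))
      ≈⟨ refl⟩∘⟨ refl⟩∘⟨ refl⟩∘⟨ trans (refl⟩∘⟨ α-iso⊗ʳ) identityʳ ⟩
    (id ⊗₁ α⁻¹) ∘ (α⁻¹ ∘ ((θ ⊗₁ id) ∘ α)) ∎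

  τ-assoc : ∀ {A B C D E F} →
            α {A ⊗₀ D} {B ⊗₀ E} {C ⊗₀ F} ∘ ((id ⊗₁ τ) ∘ τ)
            ≈ (τ {A} {B} {D} {E} ⊗₁ id) ∘ (τ {A ⊗₀ B} {C} {D ⊗₀ E} {F} ∘ (α ⊗₁ α))
  τ-assoc {A} {B} {C} {D} {E} {F} =
    trans lhs-factor (trans (refl⟩∘⟨ refl⟩∘⟨ id⊗-resp cores-agree ⟩∘⟨refl) (sym rhs-factor))
    where
    lhs-core rhs-core : Hom ((B ⊗₀ C) ⊗₀ (D ⊗₀ (E ⊗₀ F))) (D ⊗₀ ((B ⊗₀ E) ⊗₀ (C ⊗₀ F)))
    lhs-core = (id ⊗₁ τ {B} {C} {E} {F}) ∘ θ
    rhs-core = α⁻¹ ∘ ((θ {B} {D} {E} ⊗₁ id) ∘ (α ∘ ((id ⊗₁ θ {C} {D ⊗₀ E} {F}) ∘ (α⁻¹ ∘ (id ⊗₁ α)))))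

    lhs-factor : α {A ⊗₀ D} {B ⊗₀ E} {C ⊗₀ F} ∘ ((id ⊗₁ τ) ∘ τ) ≈ α ∘ (α ∘ ((id ⊗₁ lhs-core) ∘ α⁻¹))
    lhs-factor = begin
      α ∘ ((id ⊗₁ τ) ∘ (α ∘ ((id ⊗₁ θ) ∘ α⁻¹)))
        ≈⟨ refl⟩∘⟨ swapˡ α-natural₃ ⟨
      α ∘ (α ∘ ((id ⊗₁ (id ⊗₁ τ)) ∘ ((id ⊗₁ θ) ∘ α⁻¹)))
        ≈⟨ refl⟩∘⟨ refl⟩∘⟨ pullˡ id⊗∘ ⟩
      α ∘ (α ∘ ((id ⊗₁ lhs-core) ∘ α⁻¹)) ∎

    rhs-factor : (τ {A} {B} {D} {E} ⊗₁ id) ∘ (τ {A ⊗₀ B} {C} {D ⊗₀ E} {F} ∘ (α ⊗₁ α)) ≈ α ∘ (α ∘ ((id ⊗₁ rhs-core) ∘ α⁻¹))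
    rhs-factor = begin
      (τ ⊗₁ id) ∘ (τ ∘ (α ⊗₁ α))
        ≈⟨ refl⟩∘⟨ assoc² ⟩
      (τ ⊗₁ id) ∘ (α ∘ ((id ⊗₁ θ) ∘ (α⁻¹ ∘ (α ⊗₁ α))))
        ≈⟨ reassoc-≈ refl ∘⊗id⁻₃ assoc² ⟩
      (α ⊗₁ id) ∘ (((id ⊗₁ θ) ⊗₁ id) ∘ ((α⁻¹ ⊗₁ id) ∘ (α ∘ ((id ⊗₁ θ) ∘ (α⁻¹ ∘ (α ⊗₁ α))))))
        ≈⟨ refl⟩∘⟨ refl⟩∘⟨ reassoc-≈ assoc α⁻¹⊗id∘α assoc² ⟩
      (α ⊗₁ id) ∘ (((id ⊗₁ θ) ⊗₁ id) ∘ (α ∘ ((id ⊗₁ α) ∘ (α⁻¹ ∘ ((id ⊗₁ θ) ∘ (α⁻¹ ∘ (α ⊗₁ α)))))))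
        ≈⟨ refl⟩∘⟨ swapˡ α-natural ⟨
      (α ⊗₁ id) ∘ (α ∘ ((id ⊗₁ (θ ⊗₁ id)) ∘ ((id ⊗₁ α) ∘ (α⁻¹ ∘ ((id ⊗₁ θ) ∘ (α⁻¹ ∘ (α ⊗₁ α)))))))
        ≈⟨ reassoc-≈ assoc α⊗id∘α assoc² ⟩
      α ∘ (α ∘ ((id ⊗₁ α⁻¹) ∘ ((id ⊗₁ (θ ⊗₁ id)) ∘ ((id ⊗₁ α) ∘ (α⁻¹ ∘ ((id ⊗₁ θ) ∘ (α⁻¹ ∘ (α ⊗₁ α))))))))
        ≈⟨ refl⟩∘⟨ refl⟩∘⟨ refl⟩∘⟨ refl⟩∘⟨ refl⟩∘⟨ swapˡ α⁻¹-natural₃ ⟩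
      α ∘ (α ∘ ((id ⊗₁ α⁻¹) ∘ ((id ⊗₁ (θ ⊗₁ id)) ∘ ((id ⊗₁ α) ∘ ((id ⊗₁ (id ⊗₁ θ)) ∘ (α⁻¹ ∘ (α⁻¹ ∘ (α ⊗₁ α))))))))
        ≈⟨ refl⟩∘⟨ refl⟩∘⟨ refl⟩∘⟨ refl⟩∘⟨ refl⟩∘⟨ refl⟩∘⟨ reassoc-≈ assoc pentagon⁻¹ assoc² ⟩
      α ∘ (α ∘ ((id ⊗₁ α⁻¹) ∘ ((id ⊗₁ (θ ⊗₁ id)) ∘ ((id ⊗₁ α) ∘ ((id ⊗₁ (id ⊗₁ θ)) ∘ ((id ⊗₁ α⁻¹) ∘ (α⁻¹ ∘ ((α⁻¹ ⊗₁ id) ∘ (α ⊗₁ α)))))))))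
        ≈⟨ refl⟩∘⟨ refl⟩∘⟨ refl⟩∘⟨ refl⟩∘⟨ refl⟩∘⟨ refl⟩∘⟨ refl⟩∘⟨ refl⟩∘⟨ trans ⊗-∘ (α-isoˡ ⟩⊗⟨ identityˡ) ⟩
      α ∘ (α ∘ ((id ⊗₁ α⁻¹) ∘ ((id ⊗₁ (θ ⊗₁ id)) ∘ ((id ⊗₁ α) ∘ ((id ⊗₁ (id ⊗₁ θ)) ∘ ((id ⊗₁ α⁻¹) ∘ (α⁻¹ ∘ (id ⊗₁ α))))))))
        ≈⟨ refl⟩∘⟨ refl⟩∘⟨ refl⟩∘⟨ refl⟩∘⟨ refl⟩∘⟨ refl⟩∘⟨ refl⟩∘⟨ α⁻¹-natural₃ ⟩
      α ∘ (α ∘ ((id ⊗₁ α⁻¹) ∘ ((id ⊗₁ (θ ⊗₁ id)) ∘ ((id ⊗₁ α) ∘ ((id ⊗₁ (id ⊗₁ θ)) ∘ ((id ⊗₁ α⁻¹) ∘ ((id ⊗₁ (id ⊗₁ α)) ∘ α⁻¹)))))))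
        ≈⟨ refl⟩∘⟨ refl⟩∘⟨ reassoc-≈ assoc⁵ id⊗∘₆ refl ⟩
      α ∘ (α ∘ ((id ⊗₁ rhs-core) ∘ α⁻¹)) ∎

    cores-agree : lhs-core ≈ rhs-core
    cores-agree = begin
      (id ⊗₁ τ) ∘ θ
        ≈⟨ refl⟩∘⟨ θ-⊗₁ ⟩
      (id ⊗₁ τ) ∘ ((id ⊗₁ α) ∘ (θ ∘ ((id ⊗₁ θ) ∘ α⁻¹)))
        ≈⟨ pullˡ (trans id⊗∘ (trans (id⊗-resp τ∘α) id⊗∘⁻)) ⟩
      ((id ⊗₁ α) ∘ (id ⊗₁ (id ⊗₁ θ))) ∘ (θ ∘ ((id ⊗₁ θ) ∘ α⁻¹))
        ≈⟨ assoc ⟩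
      (id ⊗₁ α) ∘ ((id ⊗₁ (id ⊗₁ θ)) ∘ (θ ∘ ((id ⊗₁ θ) ∘ α⁻¹)))
        ≈⟨ refl⟩∘⟨ swapˡ (sym θ-natural) ⟩
      (id ⊗₁ α) ∘ (θ ∘ ((id ⊗₁ (id ⊗₁ θ)) ∘ ((id ⊗₁ θ) ∘ α⁻¹)))
        ≈⟨ trans (pullˡ id⊗α∘θ) assoc³ ⟩
      α⁻¹ ∘ ((θ ⊗₁ id) ∘ (α ∘ ((id ⊗₁ α) ∘ ((id ⊗₁ (id ⊗₁ θ)) ∘ ((id ⊗₁ θ) ∘ α⁻¹)))))
        ≈⟨ refl⟩∘⟨ refl⟩∘⟨ refl⟩∘⟨ reassoc-≈ assoc² id⊗∘₃ refl ⟩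
      α⁻¹ ∘ ((θ ⊗₁ id) ∘ (α ∘ ((id ⊗₁ (α ∘ ((id ⊗₁ θ) ∘ θ))) ∘ α⁻¹)))
        ≈⟨ refl⟩∘⟨ refl⟩∘⟨ refl⟩∘⟨ id⊗-resp θ∘id⊗α ⟩∘⟨refl ⟨
      α⁻¹ ∘ ((θ ⊗₁ id) ∘ (α ∘ ((id ⊗₁ (θ ∘ (id ⊗₁ α))) ∘ α⁻¹)))
        ≈⟨ refl⟩∘⟨ refl⟩∘⟨ refl⟩∘⟨ trans (refl⟩∘⟨ α⁻¹-natural₃) (pullˡ id⊗∘) ⟨
      α⁻¹ ∘ ((θ ⊗₁ id) ∘ (α ∘ ((id ⊗₁ θ) ∘ (α⁻¹ ∘ (id ⊗₁ α))))) ∎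

  τ∘τ⊗id∘α : ∀ {A B C D E F} →
             τ {A ⊗₀ C} {B ⊗₀ D} {E} {F} ∘ ((τ ⊗₁ id) ∘ α)
             ≈ (α {A} {C} {E} ⊗₁ α {B} {D} {F}) ∘ (τ ∘ (id ⊗₁ τ))
  τ∘τ⊗id∘α {A} {B} {C} {D} {E} {F} =
    trans lhs-factor (trans (refl⟩∘⟨ refl⟩∘⟨ id⊗-resp (sym cores-agree) ⟩∘⟨refl) (sym rhs-factor))
    where
    lhs-core rhs-core : Hom (B ⊗₀ ((C ⊗₀ D) ⊗₀ (E ⊗₀ F))) ((C ⊗₀ E) ⊗₀ ((B ⊗₀ D) ⊗₀ F))
    lhs-core = α ∘ ((id ⊗₁ θ {B ⊗₀ D} {E} {F}) ∘ (α⁻¹ ∘ ((θ {B} {C} {D} ⊗₁ id) ∘ α)))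
    rhs-core = (id ⊗₁ α) ∘ (θ {B} {C ⊗₀ E} {D ⊗₀ F} ∘ (id ⊗₁ τ))

    lhs-factor : τ {A ⊗₀ C} {B ⊗₀ D} {E} {F} ∘ ((τ ⊗₁ id) ∘ α) ≈ (α ⊗₁ id) ∘ (α ∘ ((id ⊗₁ lhs-core) ∘ α⁻¹))
    lhs-factor = begin
      τ ∘ ((τ ⊗₁ id) ∘ α)
        ≈⟨ assoc² ⟩
      α ∘ ((id ⊗₁ θ) ∘ (α⁻¹ ∘ ((τ ⊗₁ id) ∘ α)))
        ≈⟨ refl⟩∘⟨ refl⟩∘⟨ refl⟩∘⟨ reassoc-≈ refl ∘⊗id⁻₃ assoc² ⟩
      α ∘ ((id ⊗₁ θ) ∘ (α⁻¹ ∘ ((α ⊗₁ id) ∘ (((id ⊗₁ θ) ⊗₁ id) ∘ ((α⁻¹ ⊗₁ id) ∘ α)))))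
        ≈⟨ refl⟩∘⟨ refl⟩∘⟨ refl⟩∘⟨ refl⟩∘⟨ refl⟩∘⟨ α⁻¹⊗id∘α ⟩
      α ∘ ((id ⊗₁ θ) ∘ (α⁻¹ ∘ ((α ⊗₁ id) ∘ (((id ⊗₁ θ) ⊗₁ id) ∘ (α ∘ ((id ⊗₁ α) ∘ α⁻¹))))))
        ≈⟨ refl⟩∘⟨ refl⟩∘⟨ refl⟩∘⟨ refl⟩∘⟨ swapˡ α-natural ⟨
      α ∘ ((id ⊗₁ θ) ∘ (α⁻¹ ∘ ((α ⊗₁ id) ∘ (α ∘ ((id ⊗₁ (θ ⊗₁ id)) ∘ ((id ⊗₁ α) ∘ α⁻¹))))))
        ≈⟨ refl⟩∘⟨ refl⟩∘⟨ reassoc-≈ assoc² α⁻¹∘α⊗id∘α assoc ⟩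
      α ∘ ((id ⊗₁ θ) ∘ (α ∘ ((id ⊗₁ α⁻¹) ∘ ((id ⊗₁ (θ ⊗₁ id)) ∘ ((id ⊗₁ α) ∘ α⁻¹)))))
        ≈⟨ refl⟩∘⟨ swapˡ α-natural₃ ⟨
      α ∘ (α ∘ ((id ⊗₁ (id ⊗₁ θ)) ∘ ((id ⊗₁ α⁻¹) ∘ ((id ⊗₁ (θ ⊗₁ id)) ∘ ((id ⊗₁ α) ∘ α⁻¹)))))
        ≈⟨ reassoc-≈ assoc pentagon assoc² ⟩
      (α ⊗₁ id) ∘ (α ∘ ((id ⊗₁ α) ∘ ((id ⊗₁ (id ⊗₁ θ)) ∘ ((id ⊗₁ α⁻¹) ∘ ((id ⊗₁ (θ ⊗₁ id)) ∘ ((id ⊗₁ α) ∘ α⁻¹))))))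
        ≈⟨ refl⟩∘⟨ refl⟩∘⟨ reassoc-≈ assoc⁴ id⊗∘₅ refl ⟩
      (α ⊗₁ id) ∘ (α ∘ ((id ⊗₁ lhs-core) ∘ α⁻¹)) ∎

    rhs-factor : (α {A} {C} {E} ⊗₁ α {B} {D} {F}) ∘ (τ ∘ (id ⊗₁ τ)) ≈ (α ⊗₁ id) ∘ (α ∘ ((id ⊗₁ rhs-core) ∘ α⁻¹))
    rhs-factor = begin
      (α ⊗₁ α) ∘ (τ ∘ (id ⊗₁ τ))
        ≈⟨ refl⟩∘⟨ assoc² ⟩
      (α ⊗₁ α) ∘ (α ∘ ((id ⊗₁ θ) ∘ (α⁻¹ ∘ (id ⊗₁ τ))))
        ≈⟨ refl⟩∘⟨ refl⟩∘⟨ refl⟩∘⟨ α⁻¹-natural₃ ⟩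
      (α ⊗₁ α) ∘ (α ∘ ((id ⊗₁ θ) ∘ ((id ⊗₁ (id ⊗₁ τ)) ∘ α⁻¹)))
        ≈⟨ pushˡ serialize₁₂ ⟩
      (α ⊗₁ id) ∘ ((id ⊗₁ α) ∘ (α ∘ ((id ⊗₁ θ) ∘ ((id ⊗₁ (id ⊗₁ τ)) ∘ α⁻¹))))
        ≈⟨ refl⟩∘⟨ swapˡ α-natural₃ ⟨
      (α ⊗₁ id) ∘ (α ∘ ((id ⊗₁ (id ⊗₁ α)) ∘ ((id ⊗₁ θ) ∘ ((id ⊗₁ (id ⊗₁ τ)) ∘ α⁻¹))))
        ≈⟨ refl⟩∘⟨ refl⟩∘⟨ reassoc-≈ assoc² id⊗∘₃ refl ⟩
      (α ⊗₁ id) ∘ (α ∘ ((id ⊗₁ rhs-core) ∘ α⁻¹)) ∎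

    cores-agree : rhs-core ≈ lhs-core
    cores-agree = begin
      (id ⊗₁ α) ∘ (θ ∘ (id ⊗₁ τ))
        ≈⟨ refl⟩∘⟨ θ-⊗₂ ⟩∘⟨refl ⟩
      (id ⊗₁ α) ∘ ((α ∘ ((id ⊗₁ θ) ∘ (θ ∘ (id ⊗₁ α⁻¹)))) ∘ (id ⊗₁ τ))
        ≈⟨ refl⟩∘⟨ assoc³ ⟩
      (id ⊗₁ α) ∘ (α ∘ ((id ⊗₁ θ) ∘ (θ ∘ ((id ⊗₁ α⁻¹) ∘ (id ⊗₁ τ)))))
        ≈⟨ swapˡ α-natural₃ ⟨
      α ∘ ((id ⊗₁ (id ⊗₁ α)) ∘ ((id ⊗₁ θ) ∘ (θ ∘ ((id ⊗₁ α⁻¹) ∘ (id ⊗₁ τ)))))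
        ≈⟨ refl⟩∘⟨ refl⟩∘⟨ refl⟩∘⟨ refl⟩∘⟨ trans id⊗∘ (trans (id⊗-resp (cancelˡ α-isoˡ)) id⊗∘⁻) ⟩
      α ∘ ((id ⊗₁ (id ⊗₁ α)) ∘ ((id ⊗₁ θ) ∘ (θ ∘ ((id ⊗₁ (id ⊗₁ θ)) ∘ (id ⊗₁ α⁻¹)))))
        ≈⟨ refl⟩∘⟨ refl⟩∘⟨ refl⟩∘⟨ swapˡ θ-natural ⟩
      α ∘ ((id ⊗₁ (id ⊗₁ α)) ∘ ((id ⊗₁ θ) ∘ ((id ⊗₁ (id ⊗₁ θ)) ∘ (θ ∘ (id ⊗₁ α⁻¹)))))
        ≈⟨ refl⟩∘⟨ refl⟩∘⟨ refl⟩∘⟨ refl⟩∘⟨ θ∘id⊗α⁻¹ ⟩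
      α ∘ ((id ⊗₁ (id ⊗₁ α)) ∘ ((id ⊗₁ θ) ∘ ((id ⊗₁ (id ⊗₁ θ)) ∘ ((id ⊗₁ α⁻¹) ∘ (α⁻¹ ∘ ((θ ⊗₁ id) ∘ α))))))
        ≈⟨ refl⟩∘⟨ reassoc-≈ assoc³ id⊗∘₄ refl ⟩
      α ∘ ((id ⊗₁ ((id ⊗₁ α) ∘ (θ ∘ ((id ⊗₁ θ) ∘ α⁻¹)))) ∘ (α⁻¹ ∘ ((θ ⊗₁ id) ∘ α)))
        ≈⟨ refl⟩∘⟨ id⊗-resp θ-⊗₁ ⟩∘⟨refl ⟨
      α ∘ ((id ⊗₁ θ) ∘ (α⁻¹ ∘ ((θ ⊗₁ id) ∘ α))) ∎

  τ-σ : ∀ {A B C D} → σ ∘ τ {A} {B} {C} {D} ≈ τ ∘ (σ ⊗₁ σ)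
  τ-σ = begin
    σ ∘ (α ∘ ((id ⊗₁ θ) ∘ α⁻¹))
      ≈⟨ σ-⊗ˡ ⟩∘⟨refl ⟩
    (α⁻¹ ∘ ((σ ⊗₁ id) ∘ (α ∘ ((id ⊗₁ σ) ∘ α⁻¹)))) ∘ (α ∘ ((id ⊗₁ θ) ∘ α⁻¹))
      ≈⟨ assoc⁴ ⟩
    α⁻¹ ∘ ((σ ⊗₁ id) ∘ (α ∘ ((id ⊗₁ σ) ∘ (α⁻¹ ∘ (α ∘ ((id ⊗₁ θ) ∘ α⁻¹))))))
      ≈⟨ refl⟩∘⟨ refl⟩∘⟨ refl⟩∘⟨ refl⟩∘⟨ cancelˡ α-isoˡ ⟩
    α⁻¹ ∘ ((σ ⊗₁ id) ∘ (α ∘ ((id ⊗₁ σ) ∘ ((id ⊗₁ θ) ∘ α⁻¹))))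
      ≈⟨ refl⟩∘⟨ refl⟩∘⟨ refl⟩∘⟨ pullˡ (trans id⊗∘ (trans (id⊗-resp σ∘θ) id⊗∘⁻)) ⟩
    α⁻¹ ∘ ((σ ⊗₁ id) ∘ (α ∘ (((id ⊗₁ α) ∘ (id ⊗₁ (id ⊗₁ σ))) ∘ α⁻¹)))
      ≈⟨ refl⟩∘⟨ refl⟩∘⟨ refl⟩∘⟨ trans assoc (refl⟩∘⟨ sym α⁻¹-natural₃) ⟩
    α⁻¹ ∘ ((σ ⊗₁ id) ∘ (α ∘ ((id ⊗₁ α) ∘ (α⁻¹ ∘ (id ⊗₁ σ)))))
      ≈⟨ reassoc-≈ assoc⁴ σ-core assoc³ ⟩
    α ∘ ((id ⊗₁ θ) ∘ (α⁻¹ ∘ ((σ ⊗₁ id) ∘ (id ⊗₁ σ))))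
      ≈⟨ refl⟩∘⟨ refl⟩∘⟨ refl⟩∘⟨ serialize₁₂ ⟨
    α ∘ ((id ⊗₁ θ) ∘ (α⁻¹ ∘ (σ ⊗₁ σ)))
      ≈⟨ assoc² ⟨
    τ ∘ (σ ⊗₁ σ) ∎
    where
    σ∘θ : ∀ {B C D} → σ {C} {B ⊗₀ D} ∘ θ {B} {C} {D} ≈ α ∘ (id ⊗₁ σ)
    σ∘θ = begin
      σ ∘ θ
        ≈⟨ σ-⊗ʳ ⟩∘⟨refl ⟩
      (α ∘ ((id ⊗₁ σ) ∘ (α⁻¹ ∘ ((σ ⊗₁ id) ∘ α)))) ∘ (α⁻¹ ∘ ((σ ⊗₁ id) ∘ α))
        ≈⟨ assoc⁴ ⟩
      α ∘ ((id ⊗₁ σ) ∘ (α⁻¹ ∘ ((σ ⊗₁ id) ∘ (α ∘ (α⁻¹ ∘ ((σ ⊗₁ id) ∘ α))))))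
        ≈⟨ refl⟩∘⟨ refl⟩∘⟨ refl⟩∘⟨ refl⟩∘⟨ cancelˡ α-isoʳ ⟩
      α ∘ ((id ⊗₁ σ) ∘ (α⁻¹ ∘ ((σ ⊗₁ id) ∘ ((σ ⊗₁ id) ∘ α))))
        ≈⟨ refl⟩∘⟨ refl⟩∘⟨ refl⟩∘⟨ cancelˡ (⊗-iso σ-involutive identityˡ) ⟩
      α ∘ ((id ⊗₁ σ) ∘ (α⁻¹ ∘ α))
        ≈⟨ refl⟩∘⟨ trans (refl⟩∘⟨ α-isoˡ) identityʳ ⟩
      α ∘ (id ⊗₁ σ) ∎

    σ-core : ∀ {X Y Z W} →
             α⁻¹ ∘ ((σ {X} {Y ⊗₀ Z} ⊗₁ id {W}) ∘ (α ∘ ((id ⊗₁ α) ∘ α⁻¹)))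
             ≈ α ∘ ((id ⊗₁ θ) ∘ (α⁻¹ ∘ (σ ⊗₁ id)))
    σ-core = begin
      α⁻¹ ∘ ((σ ⊗₁ id) ∘ (α ∘ ((id ⊗₁ α) ∘ α⁻¹)))
        ≈⟨ refl⟩∘⟨ trans (⊗id-resp σ-⊗ʳ) ∘⊗id⁻₅ ⟩∘⟨refl ⟩
      α⁻¹ ∘ (((α ⊗₁ id) ∘ (((id ⊗₁ σ) ⊗₁ id) ∘ ((α⁻¹ ⊗₁ id) ∘ (((σ ⊗₁ id) ⊗₁ id) ∘ (α ⊗₁ id))))) ∘ (α ∘ ((id ⊗₁ α) ∘ α⁻¹)))
        ≈⟨ refl⟩∘⟨ assoc⁴ ⟩
      α⁻¹ ∘ ((α ⊗₁ id) ∘ (((id ⊗₁ σ) ⊗₁ id) ∘ ((α⁻¹ ⊗₁ id) ∘ (((σ ⊗₁ id) ⊗₁ id) ∘ ((α ⊗₁ id) ∘ (α ∘ ((id ⊗₁ α) ∘ α⁻¹)))))))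
        ≈⟨ refl⟩∘⟨ refl⟩∘⟨ refl⟩∘⟨ refl⟩∘⟨ refl⟩∘⟨ α⊗id∘α∘id⊗α∘α⁻¹ ⟩
      α⁻¹ ∘ ((α ⊗₁ id) ∘ (((id ⊗₁ σ) ⊗₁ id) ∘ ((α⁻¹ ⊗₁ id) ∘ (((σ ⊗₁ id) ⊗₁ id) ∘ α))))
        ≈⟨ refl⟩∘⟨ refl⟩∘⟨ refl⟩∘⟨ refl⟩∘⟨ α-natural₁ ⟨
      α⁻¹ ∘ ((α ⊗₁ id) ∘ (((id ⊗₁ σ) ⊗₁ id) ∘ ((α⁻¹ ⊗₁ id) ∘ (α ∘ (σ ⊗₁ id)))))
        ≈⟨ refl⟩∘⟨ refl⟩∘⟨ refl⟩∘⟨ reassoc-≈ assoc α⁻¹⊗id∘α assoc² ⟩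
      α⁻¹ ∘ ((α ⊗₁ id) ∘ (((id ⊗₁ σ) ⊗₁ id) ∘ (α ∘ ((id ⊗₁ α) ∘ (α⁻¹ ∘ (σ ⊗₁ id))))))
        ≈⟨ refl⟩∘⟨ refl⟩∘⟨ swapˡ α-natural ⟨
      α⁻¹ ∘ ((α ⊗₁ id) ∘ (α ∘ ((id ⊗₁ (σ ⊗₁ id)) ∘ ((id ⊗₁ α) ∘ (α⁻¹ ∘ (σ ⊗₁ id))))))
        ≈⟨ reassoc-≈ assoc² α⁻¹∘α⊗id∘α assoc ⟩
      α ∘ ((id ⊗₁ α⁻¹) ∘ ((id ⊗₁ (σ ⊗₁ id)) ∘ ((id ⊗₁ α) ∘ (α⁻¹ ∘ (σ ⊗₁ id)))))
        ≈⟨ refl⟩∘⟨ reassoc-≈ assoc² id⊗∘₃ refl ⟩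
      α ∘ ((id ⊗₁ θ) ∘ (α⁻¹ ∘ (σ ⊗₁ id))) ∎

  θ-unit : ∀ {X Y} → θ {K} {X} {Y} ≈ (id ⊗₁ ℓ⁻¹) ∘ ℓ
  θ-unit = begin
    α⁻¹ ∘ ((σ ⊗₁ id) ∘ α)
      ≈⟨ refl⟩∘⟨ (trans (⊗id-resp σK≈ρ⁻¹∘ℓ) ∘⊗id⁻) ⟩∘⟨refl ⟩
    α⁻¹ ∘ (((ρ⁻¹ ⊗₁ id) ∘ (ℓ ⊗₁ id)) ∘ α)
      ≈⟨ refl⟩∘⟨ assoc ⟩
    α⁻¹ ∘ ((ρ⁻¹ ⊗₁ id) ∘ ((ℓ ⊗₁ id) ∘ α))
      ≈⟨ pullˡ α⁻¹∘ρ⁻¹⊗id ⟩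
    (id ⊗₁ ℓ⁻¹) ∘ ((ℓ ⊗₁ id) ∘ α)
      ≈⟨ refl⟩∘⟨ kellyˡ ⟩
    (id ⊗₁ ℓ⁻¹) ∘ ℓ ∎

  τ∘ℓ⁻¹⊗id∘ℓ⁻¹ : ∀ {X Y} → τ {K} {K} {X} {Y} ∘ ((ℓ⁻¹ ⊗₁ id) ∘ ℓ⁻¹) ≈ ℓ⁻¹ ⊗₁ ℓ⁻¹
  τ∘ℓ⁻¹⊗id∘ℓ⁻¹ = begin
    τ ∘ ((ℓ⁻¹ ⊗₁ id) ∘ ℓ⁻¹)
      ≈⟨ assoc² ⟩
    α ∘ ((id ⊗₁ θ) ∘ (α⁻¹ ∘ ((ℓ⁻¹ ⊗₁ id) ∘ ℓ⁻¹)))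
      ≈⟨ refl⟩∘⟨ refl⟩∘⟨ pullˡ α⁻¹∘ℓ⁻¹⊗id ⟩
    α ∘ ((id ⊗₁ θ) ∘ (ℓ⁻¹ ∘ ℓ⁻¹))
      ≈⟨ refl⟩∘⟨ swapˡ ℓ⁻¹-natural ⟨
    α ∘ (ℓ⁻¹ ∘ (θ ∘ ℓ⁻¹))
      ≈⟨ refl⟩∘⟨ refl⟩∘⟨ (θ-unit ⟩∘⟨refl) ⟩
    α ∘ (ℓ⁻¹ ∘ (((id ⊗₁ ℓ⁻¹) ∘ ℓ) ∘ ℓ⁻¹))
      ≈⟨ refl⟩∘⟨ refl⟩∘⟨ cancelʳ ℓ-isoʳ ⟩
    α ∘ (ℓ⁻¹ ∘ (id ⊗₁ ℓ⁻¹))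
      ≈⟨ pullˡ α∘ℓ⁻¹ ⟩
    (ℓ⁻¹ ⊗₁ id) ∘ (id ⊗₁ ℓ⁻¹)
      ≈⟨ serialize₁₂ ⟨
    ℓ⁻¹ ⊗₁ ℓ⁻¹ ∎

  τ-unitˡ : ∀ {P X} → ℓ ∘ ((ℓ ⊗₁ id) ∘ (τ {K} {P} {K} {X} ∘ (ℓ⁻¹ ⊗₁ id))) ≈ id ⊗₁ ℓ
  τ-unitˡ = begin
    ℓ ∘ ((ℓ ⊗₁ id) ∘ (τ ∘ (ℓ⁻¹ ⊗₁ id)))
      ≈⟨ refl⟩∘⟨ refl⟩∘⟨ assoc² ⟩
    ℓ ∘ ((ℓ ⊗₁ id) ∘ (α ∘ ((id ⊗₁ θ) ∘ (α⁻¹ ∘ (ℓ⁻¹ ⊗₁ id)))))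
      ≈⟨ refl⟩∘⟨ pullˡ kellyˡ ⟩
    ℓ ∘ (ℓ ∘ ((id ⊗₁ θ) ∘ (α⁻¹ ∘ (ℓ⁻¹ ⊗₁ id))))
      ≈⟨ refl⟩∘⟨ swapˡ ℓ-natural ⟩
    ℓ ∘ (θ ∘ (ℓ ∘ (α⁻¹ ∘ (ℓ⁻¹ ⊗₁ id))))
      ≈⟨ refl⟩∘⟨ refl⟩∘⟨ refl⟩∘⟨ α⁻¹∘ℓ⁻¹⊗id ⟩
    ℓ ∘ (θ ∘ (ℓ ∘ ℓ⁻¹))
      ≈⟨ refl⟩∘⟨ trans (refl⟩∘⟨ ℓ-isoʳ) identityʳ ⟩
    ℓ ∘ (α⁻¹ ∘ ((σ ⊗₁ id) ∘ α))
      ≈⟨ pullˡ ℓ∘α⁻¹ ⟩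
    (ℓ ⊗₁ id) ∘ ((σ ⊗₁ id) ∘ α)
      ≈⟨ pullˡ ∘⊗id ⟩
    ((ℓ ∘ σ) ⊗₁ id) ∘ α
      ≈⟨ ⊗id-resp ℓ∘σ ⟩∘⟨refl ⟩
    (ρ ⊗₁ id) ∘ α
      ≈⟨ triangle ⟩
    id ⊗₁ ℓ ∎

  τ-unitʳ : ∀ {P X} → ρ ∘ ((id ⊗₁ ℓ) ∘ (τ {P} {K} {X} {K} ∘ (ρ⁻¹ ⊗₁ id))) ≈ id ⊗₁ ρ
  τ-unitʳ = begin
    ρ ∘ ((id ⊗₁ ℓ) ∘ (τ ∘ (ρ⁻¹ ⊗₁ id)))
      ≈⟨ refl⟩∘⟨ refl⟩∘⟨ assoc² ⟩
    ρ ∘ ((id ⊗₁ ℓ) ∘ (α ∘ ((id ⊗₁ θ) ∘ (α⁻¹ ∘ (ρ⁻¹ ⊗₁ id)))))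
      ≈⟨ refl⟩∘⟨ swapˡ α-natural₃ ⟨
    ρ ∘ (α ∘ ((id ⊗₁ (id ⊗₁ ℓ)) ∘ ((id ⊗₁ θ) ∘ (α⁻¹ ∘ (ρ⁻¹ ⊗₁ id)))))
      ≈⟨ pullˡ kellyʳ ⟩
    (id ⊗₁ ρ) ∘ ((id ⊗₁ (id ⊗₁ ℓ)) ∘ ((id ⊗₁ θ) ∘ (α⁻¹ ∘ (ρ⁻¹ ⊗₁ id))))
      ≈⟨ refl⟩∘⟨ refl⟩∘⟨ refl⟩∘⟨ α⁻¹∘ρ⁻¹⊗id ⟩
    (id ⊗₁ ρ) ∘ ((id ⊗₁ (id ⊗₁ ℓ)) ∘ ((id ⊗₁ θ) ∘ (id ⊗₁ ℓ⁻¹)))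
      ≈⟨ id⊗∘₄ ⟩
    id ⊗₁ (ρ ∘ ((id ⊗₁ ℓ) ∘ (θ ∘ ℓ⁻¹)))
      ≈⟨ id⊗-resp ρ∘id⊗ℓ∘θ∘ℓ⁻¹ ⟩
    id ⊗₁ ρ ∎
    where
    ρ∘id⊗ℓ∘θ∘ℓ⁻¹ : ∀ {X} → ρ ∘ ((id ⊗₁ ℓ) ∘ (θ {K} {X} {K} ∘ ℓ⁻¹)) ≈ ρ
    ρ∘id⊗ℓ∘θ∘ℓ⁻¹ = begin
      ρ ∘ ((id ⊗₁ ℓ) ∘ (θ ∘ ℓ⁻¹))                    ≈⟨ refl⟩∘⟨ refl⟩∘⟨ θ-unit ⟩∘⟨refl ⟩
      ρ ∘ ((id ⊗₁ ℓ) ∘ (((id ⊗₁ ℓ⁻¹) ∘ ℓ) ∘ ℓ⁻¹))   ≈⟨ refl⟩∘⟨ refl⟩∘⟨ cancelʳ ℓ-isoʳ ⟩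
      ρ ∘ ((id ⊗₁ ℓ) ∘ (id ⊗₁ ℓ⁻¹))                 ≈⟨ refl⟩∘⟨ ⊗-iso identityˡ ℓ-isoʳ ⟩
      ρ ∘ id                                         ≈⟨ identityʳ ⟩
      ρ                                              ∎

module Modality {o h r} (𝕏 : SymMonCat o h r) (M : MonoidalCoalgebraModality 𝕏) where
  open Interchange 𝕏 public
  open MonoidalCoalgebraModality M public

  !-iso : ∀ {X Y} {f : Hom X Y} {f' : Hom Y X} → f' ∘ f ≈ id → !₁ f' ∘ !₁ f ≈ id
  !-iso p = trans (sym !-homomorphism) (trans (!-resp-≈ p) !-identity)

  !-homomorphism₃ : ∀ {X Y Z W} {f : Hom X Y} {g : Hom Y Z} {k : Hom Z W} → !₁ k ∘ (!₁ g ∘ !₁ f) ≈ !₁ (k ∘ (g ∘ f))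
  !-homomorphism₃ = trans (refl⟩∘⟨ sym !-homomorphism) (sym !-homomorphism)

  m-id⊗ : ∀ {X Y Y'} {g : Hom Y Y'} → m ∘ (id { !₀ X} ⊗₁ !₁ g) ≈ !₁ (id ⊗₁ g) ∘ m
  m-id⊗ = trans (refl⟩∘⟨ (sym !-identity ⟩⊗⟨ refl)) m-natural

  m-⊗id : ∀ {X X' Y} {g : Hom X X'} → m ∘ (!₁ g ⊗₁ id { !₀ Y}) ≈ !₁ (g ⊗₁ id) ∘ m
  m-⊗id = trans (refl⟩∘⟨ (refl ⟩⊗⟨ sym !-identity)) m-natural

  m-assoc⁻¹ : ∀ {X Y Z} → m ∘ ((id ⊗₁ m) ∘ α⁻¹) ≈ !₁ α⁻¹ ∘ (m ∘ (m {X} {Y} ⊗₁ id { !₀ Z}))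
  m-assoc⁻¹ = switchˡ (!-iso α-isoˡ) (begin
    !₁ α ∘ (m ∘ ((id ⊗₁ m) ∘ α⁻¹))   ≈⟨ assoc² ⟨
    (!₁ α ∘ (m ∘ (id ⊗₁ m))) ∘ α⁻¹   ≈⟨ m-assoc ⟩∘⟨refl ⟨
    (m ∘ ((m ⊗₁ id) ∘ α)) ∘ α⁻¹      ≈⟨ assoc² ⟩
    m ∘ ((m ⊗₁ id) ∘ (α ∘ α⁻¹))      ≈⟨ refl⟩∘⟨ trans (refl⟩∘⟨ α-isoʳ) identityʳ ⟩
    m ∘ (m ⊗₁ id) ∎)

  m-θ : ∀ {X Y Z} → !₁ θ ∘ (m ∘ (id ⊗₁ m)) ≈ m ∘ ((id ⊗₁ m) ∘ θ { !₀ X} { !₀ Y} { !₀ Z})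
  m-θ = sym (begin
    m ∘ ((id ⊗₁ m) ∘ (α⁻¹ ∘ ((σ ⊗₁ id) ∘ α)))
      ≈⟨ reassoc-≈ assoc² m-assoc⁻¹ assoc² ⟩
    !₁ α⁻¹ ∘ (m ∘ ((m ⊗₁ id) ∘ ((σ ⊗₁ id) ∘ α)))
      ≈⟨ refl⟩∘⟨ refl⟩∘⟨ swapˡ (⊗-square m-symmetric id-comm) ⟩
    !₁ α⁻¹ ∘ (m ∘ ((!₁ σ ⊗₁ id) ∘ ((m ⊗₁ id) ∘ α)))
      ≈⟨ refl⟩∘⟨ swapˡ m-⊗id ⟩
    !₁ α⁻¹ ∘ (!₁ (σ ⊗₁ id) ∘ (m ∘ ((m ⊗₁ id) ∘ α)))
      ≈⟨ refl⟩∘⟨ refl⟩∘⟨ m-assoc ⟩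
    !₁ α⁻¹ ∘ (!₁ (σ ⊗₁ id) ∘ (!₁ α ∘ (m ∘ (id ⊗₁ m))))
      ≈⟨ reassoc-≈ assoc² !-homomorphism₃ refl ⟩
    !₁ θ ∘ (m ∘ (id ⊗₁ m)) ∎)

  m-τ : ∀ {X Y Z W} → !₁ τ ∘ (m ∘ (m ⊗₁ m)) ≈ m ∘ ((m ⊗₁ m) ∘ τ { !₀ X} { !₀ Y} { !₀ Z} { !₀ W})
  m-τ = sym (begin
    m ∘ ((m ⊗₁ m) ∘ (α ∘ ((id ⊗₁ θ) ∘ α⁻¹)))
      ≈⟨ refl⟩∘⟨ pushˡ serialize₁₂ ⟩
    m ∘ ((m ⊗₁ id) ∘ ((id ⊗₁ m) ∘ (α ∘ ((id ⊗₁ θ) ∘ α⁻¹))))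
      ≈⟨ refl⟩∘⟨ refl⟩∘⟨ swapˡ α-natural₃ ⟨
    m ∘ ((m ⊗₁ id) ∘ (α ∘ ((id ⊗₁ (id ⊗₁ m)) ∘ ((id ⊗₁ θ) ∘ α⁻¹))))
      ≈⟨ reassoc-≈ assoc² m-assoc assoc² ⟩
    !₁ α ∘ (m ∘ ((id ⊗₁ m) ∘ ((id ⊗₁ (id ⊗₁ m)) ∘ ((id ⊗₁ θ) ∘ α⁻¹))))
      ≈⟨ refl⟩∘⟨ refl⟩∘⟨ reassoc-≈ assoc² (trans id⊗∘₃ (trans (id⊗-resp (sym m-θ)) id⊗∘⁻₃)) assoc² ⟩
    !₁ α ∘ (m ∘ ((id ⊗₁ !₁ θ) ∘ ((id ⊗₁ m) ∘ ((id ⊗₁ (id ⊗₁ m)) ∘ α⁻¹))))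
      ≈⟨ refl⟩∘⟨ swapˡ m-id⊗ ⟩
    !₁ α ∘ (!₁ (id ⊗₁ θ) ∘ (m ∘ ((id ⊗₁ m) ∘ ((id ⊗₁ (id ⊗₁ m)) ∘ α⁻¹))))
      ≈⟨ refl⟩∘⟨ refl⟩∘⟨ refl⟩∘⟨ refl⟩∘⟨ α⁻¹-natural₃ ⟨
    !₁ α ∘ (!₁ (id ⊗₁ θ) ∘ (m ∘ ((id ⊗₁ m) ∘ (α⁻¹ ∘ (id ⊗₁ m)))))
      ≈⟨ refl⟩∘⟨ refl⟩∘⟨ reassoc-≈ assoc² m-assoc⁻¹ assoc² ⟩
    !₁ α ∘ (!₁ (id ⊗₁ θ) ∘ (!₁ α⁻¹ ∘ (m ∘ ((m ⊗₁ id) ∘ (id ⊗₁ m)))))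
      ≈⟨ refl⟩∘⟨ refl⟩∘⟨ refl⟩∘⟨ refl⟩∘⟨ serialize₁₂ ⟨
    !₁ α ∘ (!₁ (id ⊗₁ θ) ∘ (!₁ α⁻¹ ∘ (m ∘ (m ⊗₁ m))))
      ≈⟨ reassoc-≈ assoc² !-homomorphism₃ refl ⟩
    !₁ τ ∘ (m ∘ (m ⊗₁ m)) ∎)

  m∘mK⊗id∘ℓ⁻¹ : ∀ {X} → m ∘ ((mK ⊗₁ id) ∘ ℓ⁻¹) ≈ !₁ (ℓ⁻¹ {X})
  m∘mK⊗id∘ℓ⁻¹ = trans sym-assoc (trans (switchˡ (!-iso ℓ-isoˡ) m-unitˡ ⟩∘⟨refl) (cancelʳ ℓ-isoʳ))

  e⊗id∘Δ : ∀ {A} → (e ⊗₁ id) ∘ Δ {A} ≈ ℓ⁻¹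
  e⊗id∘Δ = trans (switchˡ ℓ-isoˡ Δ-counitˡ) identityʳ

  id⊗e∘Δ : ∀ {A} → (id ⊗₁ e) ∘ Δ {A} ≈ ρ⁻¹
  id⊗e∘Δ = trans (switchˡ ρ-isoˡ Δ-counitʳ) identityʳ

  infix 10 _♯

  -- g ♯ is the !-coalgebra morphism into the cofree coalgebra !C induced by g, for the coalgebra
  -- structure m ∘ (δ ⊗ δ) on !A ⊗ !B.
  _♯ : ∀ {A B C} → Hom (!₀ A ⊗₀ !₀ B) C → Hom (!₀ A ⊗₀ !₀ B) (!₀ C)
  _♯ {A} {B} g = !₁ g ∘ (m { !₀ A} { !₀ B} ∘ (δ ⊗₁ δ))

  ε∘♯ : ∀ {A B C} {g : Hom (!₀ A ⊗₀ !₀ B) C} → ε ∘ g ♯ ≈ g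
  ε∘♯ {g = g} = begin
    ε ∘ (!₁ g ∘ (m ∘ (δ ⊗₁ δ)))      ≈⟨ swapˡ ε-natural ⟩
    g ∘ (ε ∘ (m ∘ (δ ⊗₁ δ)))         ≈⟨ refl⟩∘⟨ pullˡ ε-m ⟩
    g ∘ ((ε ⊗₁ ε) ∘ (δ ⊗₁ δ))        ≈⟨ refl⟩∘⟨ ⊗-iso comonad-idˡ comonad-idˡ ⟩
    g ∘ id                           ≈⟨ identityʳ ⟩
    g                                ∎

  δ∘♯ : ∀ {A B C} {g : Hom (!₀ A ⊗₀ !₀ B) C} → δ ∘ g ♯ ≈ (g ♯) ♯
  δ∘♯ {g = g} = begin
    δ ∘ (!₁ g ∘ (m ∘ (δ ⊗₁ δ)))                           ≈⟨ swapˡ δ-natural ⟩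
    !₁ (!₁ g) ∘ (δ ∘ (m ∘ (δ ⊗₁ δ)))                      ≈⟨ refl⟩∘⟨ reassoc-≈ assoc δ-m assoc² ⟩
    !₁ (!₁ g) ∘ (!₁ m ∘ (m ∘ ((δ ⊗₁ δ) ∘ (δ ⊗₁ δ))))       ≈⟨ refl⟩∘⟨ refl⟩∘⟨ refl⟩∘⟨ δ⊗δ∘δ⊗δ ⟩
    !₁ (!₁ g) ∘ (!₁ m ∘ (m ∘ ((!₁ δ ⊗₁ !₁ δ) ∘ (δ ⊗₁ δ)))) ≈⟨ refl⟩∘⟨ refl⟩∘⟨ swapˡ m-natural ⟩
    !₁ (!₁ g) ∘ (!₁ m ∘ (!₁ (δ ⊗₁ δ) ∘ (m ∘ (δ ⊗₁ δ))))   ≈⟨ reassoc-≈ assoc² !-homomorphism₃ refl ⟩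
    !₁ (!₁ g ∘ (m ∘ (δ ⊗₁ δ))) ∘ (m ∘ (δ ⊗₁ δ))           ∎
    where
    δ⊗δ∘δ⊗δ : (δ ⊗₁ δ) ∘ (δ ⊗₁ δ) ≈ (!₁ δ ⊗₁ !₁ δ) ∘ (δ ⊗₁ δ)
    δ⊗δ∘δ⊗δ = ⊗-square (sym comonad-assoc) (sym comonad-assoc)

  e∘♯ : ∀ {A B C} {g : Hom (!₀ A ⊗₀ !₀ B) C} → e ∘ g ♯ ≈ ℓ ∘ (e ⊗₁ e)
  e∘♯ {g = g} = begin
    e ∘ (!₁ g ∘ (m ∘ (δ ⊗₁ δ)))   ≈⟨ pullˡ e-natural ⟩
    e ∘ (m ∘ (δ ⊗₁ δ))            ≈⟨ pullˡ e-m ⟩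
    (ℓ ∘ (e ⊗₁ e)) ∘ (δ ⊗₁ δ)     ≈⟨ assoc ⟩
    ℓ ∘ ((e ⊗₁ e) ∘ (δ ⊗₁ δ))     ≈⟨ refl⟩∘⟨ trans ⊗-∘ (δ-e ⟩⊗⟨ δ-e) ⟩
    ℓ ∘ (e ⊗₁ e)                  ∎

module CocommutativeBimonoid {o h r} (𝕏 : SymMonCat o h r) (Ad : Additive 𝕏)
                             (M : MonoidalCoalgebraModality 𝕏) (A : SymMonCat.Obj 𝕏) where
  open Modality 𝕏 M
  open Additive Ad
  open Prop73Data 𝕏 Ad M A

  P : Obj
  P = !₀ A

  δ₀ : Hom P (!₀ P)
  δ₀ = δ

  ε₀ : Hom P A
  ε₀ = ε

  e₀ : Hom P K
  e₀ = e

  Δ₀ : Hom P (P ⊗₀ P)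
  Δ₀ = Δ

  -- ∇ is definitionally εe+eε ♯.
  εe+eε : Hom (P ⊗₀ P) A
  εe+eε = ρ ∘ (ε₀ ⊗₁ e₀) + ℓ ∘ (e₀ ⊗₁ ε₀)

  δ∘u : δ₀ ∘ u ≈ !₁ u ∘ mK
  δ∘u = begin
    δ₀ ∘ (!₁ 0h ∘ mK)          ≈⟨ swapˡ δ-natural ⟩
    !₁ (!₁ 0h) ∘ (δ ∘ mK)     ≈⟨ refl⟩∘⟨ δ-mK ⟩
    !₁ (!₁ 0h) ∘ (!₁ mK ∘ mK) ≈⟨ pullˡ (sym !-homomorphism) ⟩
    !₁ (!₁ 0h ∘ mK) ∘ mK ∎

  ε∘u : ε₀ ∘ u ≈ 0h
  ε∘u = trans (pullˡ ε-natural) (trans (∘-zeroˡ ⟩∘⟨refl) ∘-zeroˡ)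

  e∘u : e₀ ∘ u ≈ id
  e∘u = trans (pullˡ e-natural) e-mK

  ∇-assoc : ∇ ∘ (id ⊗₁ ∇) ≈ ∇ ∘ ((∇ ⊗₁ id) ∘ α)
  ∇-assoc = trans ∇∘id⊗∇ (trans (!-resp-≈ (trans εe+eε∘id⊗∇ (sym εe+eε∘∇⊗id∘α)) ⟩∘⟨refl) (sym ∇∘∇⊗id∘α))
    where
    εee eεe eeε : Hom (P ⊗₀ (P ⊗₀ P)) A
    εee = ρ ∘ (ε₀ ⊗₁ (ℓ ∘ (e₀ ⊗₁ e₀)))
    eεe = ℓ ∘ (e₀ ⊗₁ (ρ ∘ (ε₀ ⊗₁ e₀)))
    eeε = ℓ ∘ (e₀ ⊗₁ (ℓ ∘ (e₀ ⊗₁ ε₀)))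

    εe+eε∘id⊗∇ : εe+eε ∘ (id ⊗₁ ∇) ≈ εee + (eεe + eeε)
    εe+eε∘id⊗∇ = begin
      (ρ ∘ (ε₀ ⊗₁ e₀) + ℓ ∘ (e₀ ⊗₁ ε₀)) ∘ (id ⊗₁ ∇)
        ≈⟨ ∘-distribʳ-+ ⟩
      (ρ ∘ (ε₀ ⊗₁ e₀)) ∘ (id ⊗₁ ∇) + (ℓ ∘ (e₀ ⊗₁ ε₀)) ∘ (id ⊗₁ ∇)
        ≈⟨ +-resp-≈ (trans assoc (refl⟩∘⟨ trans ⊗-∘ (identityʳ ⟩⊗⟨ e∘♯)))
                    (trans assoc (refl⟩∘⟨ trans ⊗-∘ (identityʳ ⟩⊗⟨ ε∘♯))) ⟩
      εee + ℓ ∘ (e₀ ⊗₁ εe+eε)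
        ≈⟨ +-resp-≈ refl (trans (refl⟩∘⟨ ⊗-distribˡ-+) ∘-distribˡ-+) ⟩
      εee + (eεe + eeε) ∎

    εee-reassoc : ρ ∘ (((ρ ∘ (ε₀ ⊗₁ e₀)) ⊗₁ e₀) ∘ α) ≈ εee
    εee-reassoc = begin
      ρ ∘ (((ρ ∘ (ε₀ ⊗₁ e₀)) ⊗₁ e₀) ∘ α)
        ≈⟨ refl⟩∘⟨ trans (⊗-factorˡ ⟩∘⟨refl) assoc ⟩
      ρ ∘ ((ρ ⊗₁ id) ∘ (((ε₀ ⊗₁ e₀) ⊗₁ e₀) ∘ α))
        ≈⟨ refl⟩∘⟨ refl⟩∘⟨ α-natural ⟨
      ρ ∘ ((ρ ⊗₁ id) ∘ (α ∘ (ε₀ ⊗₁ (e₀ ⊗₁ e₀))))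
        ≈⟨ refl⟩∘⟨ pullˡ triangle ⟩
      ρ ∘ ((id ⊗₁ ℓ) ∘ (ε₀ ⊗₁ (e₀ ⊗₁ e₀)))
        ≈⟨ refl⟩∘⟨ ⊗-factorʳ ⟨
      εee ∎

    eεe-reassoc : ρ ∘ (((ℓ ∘ (e₀ ⊗₁ ε₀)) ⊗₁ e₀) ∘ α) ≈ eεe
    eεe-reassoc = begin
      ρ ∘ (((ℓ ∘ (e₀ ⊗₁ ε₀)) ⊗₁ e₀) ∘ α)
        ≈⟨ refl⟩∘⟨ trans (⊗-factorˡ ⟩∘⟨refl) assoc ⟩
      ρ ∘ ((ℓ ⊗₁ id) ∘ (((e₀ ⊗₁ ε₀) ⊗₁ e₀) ∘ α))
        ≈⟨ refl⟩∘⟨ refl⟩∘⟨ α-natural ⟨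
      ρ ∘ ((ℓ ⊗₁ id) ∘ (α ∘ (e₀ ⊗₁ (ε₀ ⊗₁ e₀))))
        ≈⟨ swapˡ ρ-natural ⟩
      ℓ ∘ (ρ ∘ (α ∘ (e₀ ⊗₁ (ε₀ ⊗₁ e₀))))
        ≈⟨ refl⟩∘⟨ pullˡ kellyʳ ⟩
      ℓ ∘ ((id ⊗₁ ρ) ∘ (e₀ ⊗₁ (ε₀ ⊗₁ e₀)))
        ≈⟨ refl⟩∘⟨ ⊗-factorʳ ⟨
      eεe ∎

    eeε-reassoc : ℓ ∘ (((ℓ ∘ (e₀ ⊗₁ e₀)) ⊗₁ ε₀) ∘ α) ≈ eeε
    eeε-reassoc = begin
      ℓ ∘ (((ℓ ∘ (e₀ ⊗₁ e₀)) ⊗₁ ε₀) ∘ α)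
        ≈⟨ refl⟩∘⟨ trans (⊗-factorˡ ⟩∘⟨refl) assoc ⟩
      ℓ ∘ ((ℓ ⊗₁ id) ∘ (((e₀ ⊗₁ e₀) ⊗₁ ε₀) ∘ α))
        ≈⟨ refl⟩∘⟨ refl⟩∘⟨ α-natural ⟨
      ℓ ∘ ((ℓ ⊗₁ id) ∘ (α ∘ (e₀ ⊗₁ (e₀ ⊗₁ ε₀))))
        ≈⟨ refl⟩∘⟨ pullˡ kellyˡ ⟩
      ℓ ∘ (ℓ ∘ (e₀ ⊗₁ (e₀ ⊗₁ ε₀)))
        ≈⟨ refl⟩∘⟨ ℓ-K⊗ ⟩∘⟨refl ⟩
      ℓ ∘ ((id ⊗₁ ℓ) ∘ (e₀ ⊗₁ (e₀ ⊗₁ ε₀)))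
        ≈⟨ refl⟩∘⟨ ⊗-factorʳ ⟨
      eeε ∎

    εe+eε∘∇⊗id∘α : εe+eε ∘ ((∇ ⊗₁ id) ∘ α) ≈ εee + (eεe + eeε)
    εe+eε∘∇⊗id∘α = begin
      (ρ ∘ (ε₀ ⊗₁ e₀) + ℓ ∘ (e₀ ⊗₁ ε₀)) ∘ ((∇ ⊗₁ id) ∘ α)
        ≈⟨ ∘-distribʳ-+ ⟩
      (ρ ∘ (ε₀ ⊗₁ e₀)) ∘ ((∇ ⊗₁ id) ∘ α) + (ℓ ∘ (e₀ ⊗₁ ε₀)) ∘ ((∇ ⊗₁ id) ∘ α)
        ≈⟨ +-resp-≈ (trans assoc (refl⟩∘⟨ pullˡ (trans ⊗-∘ (ε∘♯ ⟩⊗⟨ identityʳ))))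
                    (trans assoc (refl⟩∘⟨ pullˡ (trans ⊗-∘ (e∘♯ ⟩⊗⟨ identityʳ)))) ⟩
      ρ ∘ ((εe+eε ⊗₁ e₀) ∘ α) + ℓ ∘ (((ℓ ∘ (e₀ ⊗₁ e₀)) ⊗₁ ε₀) ∘ α)
        ≈⟨ +-resp-≈ (trans (refl⟩∘⟨ trans (⊗-distribʳ-+ ⟩∘⟨refl) ∘-distribʳ-+) ∘-distribˡ-+) eeε-reassoc ⟩
      (ρ ∘ (((ρ ∘ (ε₀ ⊗₁ e₀)) ⊗₁ e₀) ∘ α) + ρ ∘ (((ℓ ∘ (e₀ ⊗₁ ε₀)) ⊗₁ e₀) ∘ α)) + eeε
        ≈⟨ +-resp-≈ (+-resp-≈ εee-reassoc eεe-reassoc) refl ⟩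
      (εee + eεe) + eeε
        ≈⟨ +-assoc ⟩
      εee + (eεe + eeε) ∎

    promote₃ : Hom (P ⊗₀ (P ⊗₀ P)) (!₀ (P ⊗₀ (P ⊗₀ P)))
    promote₃ = m ∘ ((id ⊗₁ m) ∘ (δ₀ ⊗₁ (δ₀ ⊗₁ δ₀)))

    ∇∘id⊗∇ : ∇ ∘ (id ⊗₁ ∇) ≈ !₁ (εe+eε ∘ (id ⊗₁ ∇)) ∘ promote₃
    ∇∘id⊗∇ = begin
      (!₁ εe+eε ∘ (m ∘ (δ₀ ⊗₁ δ₀))) ∘ (id ⊗₁ ∇)
        ≈⟨ assoc² ⟩
      !₁ εe+eε ∘ (m ∘ ((δ₀ ⊗₁ δ₀) ∘ (id ⊗₁ ∇)))
        ≈⟨ refl⟩∘⟨ refl⟩∘⟨ trans ⊗-∘ (identityʳ ⟩⊗⟨ δ∘♯) ⟩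
      !₁ εe+eε ∘ (m ∘ (δ₀ ⊗₁ (∇ ♯)))
        ≈⟨ refl⟩∘⟨ refl⟩∘⟨ ⊗-factorʳ ⟩
      !₁ εe+eε ∘ (m ∘ ((id ⊗₁ !₁ ∇) ∘ (δ₀ ⊗₁ (m ∘ (δ₀ ⊗₁ δ₀)))))
        ≈⟨ refl⟩∘⟨ swapˡ m-id⊗ ⟩
      !₁ εe+eε ∘ (!₁ (id ⊗₁ ∇) ∘ (m ∘ (δ₀ ⊗₁ (m ∘ (δ₀ ⊗₁ δ₀)))))
        ≈⟨ refl⟩∘⟨ refl⟩∘⟨ refl⟩∘⟨ ⊗-factorʳ ⟩
      !₁ εe+eε ∘ (!₁ (id ⊗₁ ∇) ∘ promote₃)
        ≈⟨ pullˡ (sym !-homomorphism) ⟩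
      !₁ (εe+eε ∘ (id ⊗₁ ∇)) ∘ promote₃ ∎

    ∇∘∇⊗id∘α : ∇ ∘ ((∇ ⊗₁ id) ∘ α) ≈ !₁ (εe+eε ∘ ((∇ ⊗₁ id) ∘ α)) ∘ promote₃
    ∇∘∇⊗id∘α = begin
      (!₁ εe+eε ∘ (m ∘ (δ₀ ⊗₁ δ₀))) ∘ ((∇ ⊗₁ id) ∘ α)
        ≈⟨ assoc² ⟩
      !₁ εe+eε ∘ (m ∘ ((δ₀ ⊗₁ δ₀) ∘ ((∇ ⊗₁ id) ∘ α)))
        ≈⟨ refl⟩∘⟨ refl⟩∘⟨ pullˡ (trans ⊗-∘ (δ∘♯ ⟩⊗⟨ identityʳ)) ⟩
      !₁ εe+eε ∘ (m ∘ (((∇ ♯) ⊗₁ δ₀) ∘ α))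
        ≈⟨ refl⟩∘⟨ refl⟩∘⟨ trans (⊗-factorˡ ⟩∘⟨refl) assoc ⟩
      !₁ εe+eε ∘ (m ∘ ((!₁ ∇ ⊗₁ id) ∘ (((m ∘ (δ₀ ⊗₁ δ₀)) ⊗₁ δ₀) ∘ α)))
        ≈⟨ refl⟩∘⟨ swapˡ m-⊗id ⟩
      !₁ εe+eε ∘ (!₁ (∇ ⊗₁ id) ∘ (m ∘ (((m ∘ (δ₀ ⊗₁ δ₀)) ⊗₁ δ₀) ∘ α)))
        ≈⟨ refl⟩∘⟨ refl⟩∘⟨ refl⟩∘⟨ trans (⊗-factorˡ ⟩∘⟨refl) assoc ⟩
      !₁ εe+eε ∘ (!₁ (∇ ⊗₁ id) ∘ (m ∘ ((m ⊗₁ id) ∘ (((δ₀ ⊗₁ δ₀) ⊗₁ δ₀) ∘ α))))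
        ≈⟨ refl⟩∘⟨ refl⟩∘⟨ refl⟩∘⟨ refl⟩∘⟨ α-natural ⟨
      !₁ εe+eε ∘ (!₁ (∇ ⊗₁ id) ∘ (m ∘ ((m ⊗₁ id) ∘ (α ∘ (δ₀ ⊗₁ (δ₀ ⊗₁ δ₀))))))
        ≈⟨ refl⟩∘⟨ refl⟩∘⟨ reassoc-≈ assoc² m-assoc assoc² ⟩
      !₁ εe+eε ∘ (!₁ (∇ ⊗₁ id) ∘ (!₁ α ∘ promote₃))
        ≈⟨ reassoc-≈ assoc² !-homomorphism₃ refl ⟩
      !₁ (εe+eε ∘ ((∇ ⊗₁ id) ∘ α)) ∘ promote₃ ∎

  εe+eε∘u⊗id : εe+eε ∘ (u ⊗₁ id) ≈ ε₀ ∘ ℓ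
  εe+eε∘u⊗id = begin
    (ρ ∘ (ε₀ ⊗₁ e₀) + ℓ ∘ (e₀ ⊗₁ ε₀)) ∘ (u ⊗₁ id)
      ≈⟨ ∘-distribʳ-+ ⟩
    (ρ ∘ (ε₀ ⊗₁ e₀)) ∘ (u ⊗₁ id) + (ℓ ∘ (e₀ ⊗₁ ε₀)) ∘ (u ⊗₁ id)
      ≈⟨ +-resp-≈ (trans assoc (refl⟩∘⟨ trans ⊗-∘ (ε∘u ⟩⊗⟨ identityʳ)))
                  (trans assoc (refl⟩∘⟨ trans ⊗-∘ (e∘u ⟩⊗⟨ identityʳ))) ⟩
    ρ ∘ (0h ⊗₁ e₀) + ℓ ∘ (id ⊗₁ ε₀)
      ≈⟨ +-resp-≈ (trans (refl⟩∘⟨ ⊗-zeroˡ) ∘-zeroʳ) ℓ-natural ⟩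
    0h + ε₀ ∘ ℓ
      ≈⟨ +-identityˡ ⟩
    ε₀ ∘ ℓ ∎

  εe+eε∘id⊗u : εe+eε ∘ (id ⊗₁ u) ≈ ε₀ ∘ ρ
  εe+eε∘id⊗u = begin
    (ρ ∘ (ε₀ ⊗₁ e₀) + ℓ ∘ (e₀ ⊗₁ ε₀)) ∘ (id ⊗₁ u)
      ≈⟨ ∘-distribʳ-+ ⟩
    (ρ ∘ (ε₀ ⊗₁ e₀)) ∘ (id ⊗₁ u) + (ℓ ∘ (e₀ ⊗₁ ε₀)) ∘ (id ⊗₁ u)
      ≈⟨ +-resp-≈ (trans assoc (refl⟩∘⟨ trans ⊗-∘ (identityʳ ⟩⊗⟨ e∘u)))
                  (trans assoc (refl⟩∘⟨ trans ⊗-∘ (identityʳ ⟩⊗⟨ ε∘u))) ⟩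
    ρ ∘ (ε₀ ⊗₁ id) + ℓ ∘ (e₀ ⊗₁ 0h)
      ≈⟨ +-resp-≈ ρ-natural (trans (refl⟩∘⟨ ⊗-zeroʳ) ∘-zeroʳ) ⟩
    ε₀ ∘ ρ + 0h
      ≈⟨ trans +-comm +-identityˡ ⟩
    ε₀ ∘ ρ ∎

  ∇-unitˡ : ∇ ∘ (u ⊗₁ id) ≈ ℓ
  ∇-unitˡ = begin
    (!₁ εe+eε ∘ (m ∘ (δ₀ ⊗₁ δ₀))) ∘ (u ⊗₁ id)
      ≈⟨ assoc² ⟩
    !₁ εe+eε ∘ (m ∘ ((δ₀ ⊗₁ δ₀) ∘ (u ⊗₁ id)))
      ≈⟨ refl⟩∘⟨ refl⟩∘⟨ trans ⊗-∘ (trans (δ∘u ⟩⊗⟨ identityʳ) ⊗-factorˡ) ⟩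
    !₁ εe+eε ∘ (m ∘ ((!₁ u ⊗₁ id) ∘ (mK ⊗₁ δ₀)))
      ≈⟨ refl⟩∘⟨ swapˡ m-⊗id ⟩
    !₁ εe+eε ∘ (!₁ (u ⊗₁ id) ∘ (m ∘ (mK ⊗₁ δ₀)))
      ≈⟨ refl⟩∘⟨ refl⟩∘⟨ refl⟩∘⟨ serialize₁₂ ⟩
    !₁ εe+eε ∘ (!₁ (u ⊗₁ id) ∘ (m ∘ ((mK ⊗₁ id) ∘ (id ⊗₁ δ₀))))
      ≈⟨ pullˡ (sym !-homomorphism) ⟩
    !₁ (εe+eε ∘ (u ⊗₁ id)) ∘ (m ∘ ((mK ⊗₁ id) ∘ (id ⊗₁ δ₀)))
      ≈⟨ trans (!-resp-≈ εe+eε∘u⊗id) !-homomorphism ⟩∘⟨refl ⟩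
    (!₁ ε₀ ∘ !₁ ℓ) ∘ (m ∘ ((mK ⊗₁ id) ∘ (id ⊗₁ δ₀)))
      ≈⟨ assoc ⟩
    !₁ ε₀ ∘ (!₁ ℓ ∘ (m ∘ ((mK ⊗₁ id) ∘ (id ⊗₁ δ₀))))
      ≈⟨ refl⟩∘⟨ reassoc-≈ assoc² m-unitˡ refl ⟩
    !₁ ε₀ ∘ (ℓ ∘ (id ⊗₁ δ₀))
      ≈⟨ refl⟩∘⟨ ℓ-natural ⟩
    !₁ ε₀ ∘ (δ₀ ∘ ℓ)
      ≈⟨ pullˡ comonad-idʳ ⟩
    id ∘ ℓ
      ≈⟨ identityˡ ⟩
    ℓ ∎

  ∇-unitʳ : ∇ ∘ (id ⊗₁ u) ≈ ρ
  ∇-unitʳ = begin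
    (!₁ εe+eε ∘ (m ∘ (δ₀ ⊗₁ δ₀))) ∘ (id ⊗₁ u)
      ≈⟨ assoc² ⟩
    !₁ εe+eε ∘ (m ∘ ((δ₀ ⊗₁ δ₀) ∘ (id ⊗₁ u)))
      ≈⟨ refl⟩∘⟨ refl⟩∘⟨ trans ⊗-∘ (trans (identityʳ ⟩⊗⟨ δ∘u) ⊗-factorʳ) ⟩
    !₁ εe+eε ∘ (m ∘ ((id ⊗₁ !₁ u) ∘ (δ₀ ⊗₁ mK)))
      ≈⟨ refl⟩∘⟨ swapˡ m-id⊗ ⟩
    !₁ εe+eε ∘ (!₁ (id ⊗₁ u) ∘ (m ∘ (δ₀ ⊗₁ mK)))
      ≈⟨ refl⟩∘⟨ refl⟩∘⟨ refl⟩∘⟨ serialize₂₁ ⟩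
    !₁ εe+eε ∘ (!₁ (id ⊗₁ u) ∘ (m ∘ ((id ⊗₁ mK) ∘ (δ₀ ⊗₁ id))))
      ≈⟨ pullˡ (sym !-homomorphism) ⟩
    !₁ (εe+eε ∘ (id ⊗₁ u)) ∘ (m ∘ ((id ⊗₁ mK) ∘ (δ₀ ⊗₁ id)))
      ≈⟨ trans (!-resp-≈ εe+eε∘id⊗u) !-homomorphism ⟩∘⟨refl ⟩
    (!₁ ε₀ ∘ !₁ ρ) ∘ (m ∘ ((id ⊗₁ mK) ∘ (δ₀ ⊗₁ id)))
      ≈⟨ assoc ⟩
    !₁ ε₀ ∘ (!₁ ρ ∘ (m ∘ ((id ⊗₁ mK) ∘ (δ₀ ⊗₁ id))))
      ≈⟨ refl⟩∘⟨ reassoc-≈ assoc² m-unitʳ refl ⟩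
    !₁ ε₀ ∘ (ρ ∘ (δ₀ ⊗₁ id))
      ≈⟨ refl⟩∘⟨ ρ-natural ⟩
    !₁ ε₀ ∘ (δ₀ ∘ ρ)
      ≈⟨ pullˡ comonad-idʳ ⟩
    id ∘ ρ
      ≈⟨ identityˡ ⟩
    ρ ∎

  Δ∘∇ : Δ₀ ∘ ∇ ≈ (∇ ⊗₁ ∇) ∘ (τ ∘ (Δ₀ ⊗₁ Δ₀))
  Δ∘∇ = begin
    Δ₀ ∘ (!₁ εe+eε ∘ (m ∘ (δ₀ ⊗₁ δ₀)))
      ≈⟨ swapˡ Δ-natural ⟩
    (!₁ εe+eε ⊗₁ !₁ εe+eε) ∘ (Δ ∘ (m ∘ (δ₀ ⊗₁ δ₀)))
      ≈⟨ refl⟩∘⟨ reassoc-≈ assoc Δ-m assoc² ⟩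
    (!₁ εe+eε ⊗₁ !₁ εe+eε) ∘ ((m ⊗₁ m) ∘ (τ ∘ ((Δ ⊗₁ Δ) ∘ (δ₀ ⊗₁ δ₀))))
      ≈⟨ refl⟩∘⟨ refl⟩∘⟨ refl⟩∘⟨ trans ⊗-∘ (trans (δ-Δ ⟩⊗⟨ δ-Δ) ⊗-homomorphism) ⟩
    (!₁ εe+eε ⊗₁ !₁ εe+eε) ∘ ((m ⊗₁ m) ∘ (τ ∘ (((δ₀ ⊗₁ δ₀) ⊗₁ (δ₀ ⊗₁ δ₀)) ∘ (Δ₀ ⊗₁ Δ₀))))
      ≈⟨ refl⟩∘⟨ refl⟩∘⟨ swapˡ τ-natural ⟩
    (!₁ εe+eε ⊗₁ !₁ εe+eε) ∘ ((m ⊗₁ m) ∘ (((δ₀ ⊗₁ δ₀) ⊗₁ (δ₀ ⊗₁ δ₀)) ∘ (τ ∘ (Δ₀ ⊗₁ Δ₀))))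
      ≈⟨ reassoc-≈ assoc² (trans (refl⟩∘⟨ ⊗-∘) ⊗-∘) refl ⟩
    (∇ ⊗₁ ∇) ∘ (τ ∘ (Δ₀ ⊗₁ Δ₀)) ∎

  Δ∘u : Δ₀ ∘ u ≈ (u ⊗₁ u) ∘ ℓ⁻¹
  Δ∘u = begin
    Δ₀ ∘ (!₁ 0h ∘ mK)                 ≈⟨ swapˡ Δ-natural ⟩
    (!₁ 0h ⊗₁ !₁ 0h) ∘ (Δ ∘ mK)       ≈⟨ refl⟩∘⟨ Δ-mK ⟩
    (!₁ 0h ⊗₁ !₁ 0h) ∘ ((mK ⊗₁ mK) ∘ ℓ⁻¹) ≈⟨ pullˡ ⊗-∘ ⟩
    (u ⊗₁ u) ∘ ℓ⁻¹ ∎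

  isCocommutativeBimonoid : IsCocommutativeBimonoid 𝕏 (!₀ A) ∇ u Δ e
  isCocommutativeBimonoid = record
    { ∇-assoc = ∇-assoc
    ; ∇-unitˡ = ∇-unitˡ
    ; ∇-unitʳ = ∇-unitʳ
    ; Δ-coassoc = Δ-coassoc
    ; Δ-counitˡ = Δ-counitˡ
    ; Δ-counitʳ = Δ-counitʳ
    ; Δ-cocomm = Δ-cocomm
    ; Δ-∇ = Δ∘∇
    ; ε-∇ = e∘♯
    ; Δ-u = Δ∘u
    ; ε-u = e∘u
    }

module ExponentialLiftingMonad {o h r} (𝕏 : SymMonCat o h r) (Ad : Additive 𝕏)
                               (M : MonoidalCoalgebraModality 𝕏) (A : SymMonCat.Obj 𝕏) where
  open Modality 𝕏 M
  open Prop73Data 𝕏 Ad M A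
  open CocommutativeBimonoid 𝕏 Ad M A

  μT-natural : ∀ {X Y} {f : Hom X Y} → μT ∘ (id ⊗₁ (id ⊗₁ f)) ≈ (id ⊗₁ f) ∘ μT
  μT-natural = trans assoc (trans (refl⟩∘⟨ α-natural₃) (swapˡ ⊗-swap))

  ηT-natural : ∀ {X Y} {f : Hom X Y} → ηT ∘ f ≈ (id ⊗₁ f) ∘ ηT
  ηT-natural = trans assoc (trans (refl⟩∘⟨ ℓ⁻¹-natural) (swapˡ ⊗-swap))

  μT-assoc : ∀ {X} → μT {X} ∘ (id ⊗₁ μT) ≈ μT ∘ μT
  μT-assoc = begin
    ((∇ ⊗₁ id) ∘ α) ∘ (id ⊗₁ ((∇ ⊗₁ id) ∘ α))
      ≈⟨ assoc ⟩
    (∇ ⊗₁ id) ∘ (α ∘ (id ⊗₁ ((∇ ⊗₁ id) ∘ α)))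
      ≈⟨ refl⟩∘⟨ refl⟩∘⟨ id⊗∘⁻ ⟩
    (∇ ⊗₁ id) ∘ (α ∘ ((id ⊗₁ (∇ ⊗₁ id)) ∘ (id ⊗₁ α)))
      ≈⟨ refl⟩∘⟨ swapˡ α-natural ⟩
    (∇ ⊗₁ id) ∘ (((id ⊗₁ ∇) ⊗₁ id) ∘ (α ∘ (id ⊗₁ α)))
      ≈⟨ pullˡ ∘⊗id ⟩
    ((∇ ∘ (id ⊗₁ ∇)) ⊗₁ id) ∘ (α ∘ (id ⊗₁ α))
      ≈⟨ ⊗id-resp ∇-assoc ⟩∘⟨refl ⟩
    ((∇ ∘ ((∇ ⊗₁ id) ∘ α)) ⊗₁ id) ∘ (α ∘ (id ⊗₁ α))
      ≈⟨ reassoc-≈ refl ∘⊗id⁻₃ assoc² ⟩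
    (∇ ⊗₁ id) ∘ (((∇ ⊗₁ id) ⊗₁ id) ∘ ((α ⊗₁ id) ∘ (α ∘ (id ⊗₁ α))))
      ≈⟨ refl⟩∘⟨ refl⟩∘⟨ pentagon ⟨
    (∇ ⊗₁ id) ∘ (((∇ ⊗₁ id) ⊗₁ id) ∘ (α ∘ α))
      ≈⟨ refl⟩∘⟨ swapˡ α-natural₁ ⟨
    (∇ ⊗₁ id) ∘ (α ∘ ((∇ ⊗₁ id) ∘ α))
      ≈⟨ assoc ⟨
    ((∇ ⊗₁ id) ∘ α) ∘ ((∇ ⊗₁ id) ∘ α) ∎

  μT∘T₁ηT : ∀ {X} → μT {X} ∘ (id ⊗₁ ηT) ≈ id
  μT∘T₁ηT = begin
    ((∇ ⊗₁ id) ∘ α) ∘ (id ⊗₁ ((u ⊗₁ id) ∘ ℓ⁻¹))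
      ≈⟨ assoc ⟩
    (∇ ⊗₁ id) ∘ (α ∘ (id ⊗₁ ((u ⊗₁ id) ∘ ℓ⁻¹)))
      ≈⟨ refl⟩∘⟨ refl⟩∘⟨ id⊗∘⁻ ⟩
    (∇ ⊗₁ id) ∘ (α ∘ ((id ⊗₁ (u ⊗₁ id)) ∘ (id ⊗₁ ℓ⁻¹)))
      ≈⟨ refl⟩∘⟨ swapˡ α-natural ⟩
    (∇ ⊗₁ id) ∘ (((id ⊗₁ u) ⊗₁ id) ∘ (α ∘ (id ⊗₁ ℓ⁻¹)))
      ≈⟨ pullˡ ∘⊗id ⟩
    ((∇ ∘ (id ⊗₁ u)) ⊗₁ id) ∘ (α ∘ (id ⊗₁ ℓ⁻¹))
      ≈⟨ ⊗id-resp ∇-unitʳ ⟩∘⟨refl ⟩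
    (ρ ⊗₁ id) ∘ (α ∘ (id ⊗₁ ℓ⁻¹))
      ≈⟨ pullˡ triangle ⟩
    (id ⊗₁ ℓ) ∘ (id ⊗₁ ℓ⁻¹)
      ≈⟨ ⊗-iso identityˡ ℓ-isoʳ ⟩
    id ∎

  μT∘ηT : ∀ {X} → μT {X} ∘ ηT ≈ id
  μT∘ηT = begin
    ((∇ ⊗₁ id) ∘ α) ∘ ((u ⊗₁ id) ∘ ℓ⁻¹)
      ≈⟨ assoc ⟩
    (∇ ⊗₁ id) ∘ (α ∘ ((u ⊗₁ id) ∘ ℓ⁻¹))
      ≈⟨ refl⟩∘⟨ swapˡ α-natural₁ ⟩
    (∇ ⊗₁ id) ∘ (((u ⊗₁ id) ⊗₁ id) ∘ (α ∘ ℓ⁻¹))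
      ≈⟨ pullˡ ∘⊗id ⟩
    ((∇ ∘ (u ⊗₁ id)) ⊗₁ id) ∘ (α ∘ ℓ⁻¹)
      ≈⟨ ⊗id-resp ∇-unitˡ ⟩∘⟨refl ⟩
    (ℓ ⊗₁ id) ∘ (α ∘ ℓ⁻¹)
      ≈⟨ refl⟩∘⟨ α∘ℓ⁻¹ ⟩
    (ℓ ⊗₁ id) ∘ (ℓ⁻¹ ⊗₁ id)
      ≈⟨ ⊗-iso ℓ-isoʳ identityˡ ⟩
    id ∎

  nT-natural : ∀ {X X' Y Y'} {f : Hom X X'} {g : Hom Y Y'} → nT ∘ (id ⊗₁ (f ⊗₁ g)) ≈ ((id ⊗₁ f) ⊗₁ (id ⊗₁ g)) ∘ nT
  nT-natural = trans assoc (trans (refl⟩∘⟨ ⊗-square id⊗id-comm id-comm) (swapˡ τ-natural))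

  nT-assoc : ∀ {X Y Z} → α ∘ ((id ⊗₁ nT {Y} {Z}) ∘ nT {X} {Y ⊗₀ Z}) ≈ (nT ⊗₁ id) ∘ (nT {X ⊗₀ Y} {Z} ∘ (id ⊗₁ α))
  nT-assoc = begin
    α ∘ ((id ⊗₁ (τ ∘ (Δ₀ ⊗₁ id))) ∘ (τ ∘ (Δ₀ ⊗₁ id)))
      ≈⟨ refl⟩∘⟨ pushˡ id⊗∘⁻ ⟩
    α ∘ ((id ⊗₁ τ) ∘ ((id ⊗₁ (Δ₀ ⊗₁ id)) ∘ (τ ∘ (Δ₀ ⊗₁ id))))
      ≈⟨ refl⟩∘⟨ refl⟩∘⟨ swapˡ τ-natural₂ ⟩
    α ∘ ((id ⊗₁ τ) ∘ (τ ∘ (((id ⊗₁ Δ₀) ⊗₁ id) ∘ (Δ₀ ⊗₁ id))))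
      ≈⟨ refl⟩∘⟨ refl⟩∘⟨ refl⟩∘⟨ ∘⊗id ⟩
    α ∘ ((id ⊗₁ τ) ∘ (τ ∘ (((id ⊗₁ Δ₀) ∘ Δ₀) ⊗₁ id)))
      ≈⟨ reassoc-≈ assoc² τ-assoc assoc² ⟩
    (τ ⊗₁ id) ∘ (τ ∘ ((α ⊗₁ α) ∘ (((id ⊗₁ Δ₀) ∘ Δ₀) ⊗₁ id)))
      ≈⟨ refl⟩∘⟨ refl⟩∘⟨ trans ⊗-∘ ((sym Δ-coassoc) ⟩⊗⟨ identityʳ) ⟩
    (τ ⊗₁ id) ∘ (τ ∘ (((Δ₀ ⊗₁ id) ∘ Δ₀) ⊗₁ α))
      ≈⟨ refl⟩∘⟨ refl⟩∘⟨ trans (refl⟩∘⟨ sym serialize₁₂) (trans ⊗-∘ (refl ⟩⊗⟨ identityˡ)) ⟨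
    (τ ⊗₁ id) ∘ (τ ∘ (((Δ₀ ⊗₁ id) ⊗₁ id) ∘ ((Δ₀ ⊗₁ id) ∘ (id ⊗₁ α))))
      ≈⟨ refl⟩∘⟨ swapˡ τ-natural₁ ⟨
    (τ ⊗₁ id) ∘ (((Δ₀ ⊗₁ id) ⊗₁ id) ∘ (τ ∘ ((Δ₀ ⊗₁ id) ∘ (id ⊗₁ α))))
      ≈⟨ reassoc-≈ refl ∘⊗id⁻ assoc ⟨
    ((τ ∘ (Δ₀ ⊗₁ id)) ⊗₁ id) ∘ (τ ∘ ((Δ₀ ⊗₁ id) ∘ (id ⊗₁ α)))
      ≈⟨ refl⟩∘⟨ assoc ⟨
    ((τ ∘ (Δ₀ ⊗₁ id)) ⊗₁ id) ∘ ((τ ∘ (Δ₀ ⊗₁ id)) ∘ (id ⊗₁ α)) ∎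

  nT-unitˡ : ∀ {X} → ℓ ∘ ((nKT ⊗₁ id) ∘ nT {K} {X}) ≈ id ⊗₁ ℓ
  nT-unitˡ = begin
    ℓ ∘ (((e₀ ∘ ρ) ⊗₁ id) ∘ (τ ∘ (Δ₀ ⊗₁ id)))
      ≈⟨ refl⟩∘⟨ trans (trans (⊗id-resp (sym ρ-natural)) ∘⊗id⁻) (⊗id-resp (sym ℓK≈ρK) ⟩∘⟨refl) ⟩∘⟨refl ⟩
    ℓ ∘ (((ℓ ⊗₁ id) ∘ ((e₀ ⊗₁ id) ⊗₁ id)) ∘ (τ ∘ (Δ₀ ⊗₁ id)))
      ≈⟨ refl⟩∘⟨ assoc ⟩
    ℓ ∘ ((ℓ ⊗₁ id) ∘ (((e₀ ⊗₁ id) ⊗₁ id) ∘ (τ ∘ (Δ₀ ⊗₁ id))))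
      ≈⟨ refl⟩∘⟨ refl⟩∘⟨ swapˡ τ-natural₁ ⟩
    ℓ ∘ ((ℓ ⊗₁ id) ∘ (τ ∘ (((e₀ ⊗₁ id) ⊗₁ id) ∘ (Δ₀ ⊗₁ id))))
      ≈⟨ refl⟩∘⟨ refl⟩∘⟨ refl⟩∘⟨ trans ∘⊗id (⊗id-resp e⊗id∘Δ) ⟩
    ℓ ∘ ((ℓ ⊗₁ id) ∘ (τ ∘ (ℓ⁻¹ ⊗₁ id)))
      ≈⟨ τ-unitˡ ⟩
    id ⊗₁ ℓ ∎

  nT-unitʳ : ∀ {X} → ρ ∘ ((id ⊗₁ nKT) ∘ nT {X} {K}) ≈ id ⊗₁ ρ
  nT-unitʳ = begin
    ρ ∘ ((id ⊗₁ (e₀ ∘ ρ)) ∘ (τ ∘ (Δ₀ ⊗₁ id)))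
      ≈⟨ refl⟩∘⟨ trans (id⊗-resp (trans (sym ρ-natural) ((sym ℓK≈ρK) ⟩∘⟨refl))) id⊗∘⁻ ⟩∘⟨refl ⟩
    ρ ∘ (((id ⊗₁ ℓ) ∘ (id ⊗₁ (e₀ ⊗₁ id))) ∘ (τ ∘ (Δ₀ ⊗₁ id)))
      ≈⟨ refl⟩∘⟨ assoc ⟩
    ρ ∘ ((id ⊗₁ ℓ) ∘ ((id ⊗₁ (e₀ ⊗₁ id)) ∘ (τ ∘ (Δ₀ ⊗₁ id))))
      ≈⟨ refl⟩∘⟨ refl⟩∘⟨ swapˡ τ-natural₂ ⟩
    ρ ∘ ((id ⊗₁ ℓ) ∘ (τ ∘ (((id ⊗₁ e₀) ⊗₁ id) ∘ (Δ₀ ⊗₁ id))))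
      ≈⟨ refl⟩∘⟨ refl⟩∘⟨ refl⟩∘⟨ trans ∘⊗id (⊗id-resp id⊗e∘Δ) ⟩
    ρ ∘ ((id ⊗₁ ℓ) ∘ (τ ∘ (ρ⁻¹ ⊗₁ id)))
      ≈⟨ τ-unitʳ ⟩
    id ⊗₁ ρ ∎

  nT-symmetric : ∀ {X Y} → σ ∘ nT {X} {Y} ≈ nT ∘ (id ⊗₁ σ)
  nT-symmetric = begin
    σ ∘ (τ ∘ (Δ₀ ⊗₁ id))
      ≈⟨ pullˡ τ-σ ⟩
    (τ ∘ (σ ⊗₁ σ)) ∘ (Δ₀ ⊗₁ id)
      ≈⟨ assoc ⟩
    τ ∘ ((σ ⊗₁ σ) ∘ (Δ₀ ⊗₁ id))
      ≈⟨ refl⟩∘⟨ trans ⊗-∘ (Δ-cocomm ⟩⊗⟨ identityʳ) ⟩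
    τ ∘ (Δ₀ ⊗₁ σ)
      ≈⟨ refl⟩∘⟨ serialize₁₂ ⟩
    τ ∘ ((Δ₀ ⊗₁ id) ∘ (id ⊗₁ σ))
      ≈⟨ assoc ⟨
    (τ ∘ (Δ₀ ⊗₁ id)) ∘ (id ⊗₁ σ) ∎

  nT∘μT : ∀ {X Y} → nT ∘ μT {X ⊗₀ Y} ≈ (μT ⊗₁ μT) ∘ (nT ∘ (id ⊗₁ nT))
  nT∘μT = begin
    (τ ∘ (Δ₀ ⊗₁ id)) ∘ ((∇ ⊗₁ id) ∘ α)
      ≈⟨ assoc ⟩
    τ ∘ ((Δ₀ ⊗₁ id) ∘ ((∇ ⊗₁ id) ∘ α))
      ≈⟨ refl⟩∘⟨ pullˡ ∘⊗id ⟩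
    τ ∘ (((Δ₀ ∘ ∇) ⊗₁ id) ∘ α)
      ≈⟨ refl⟩∘⟨ ⊗id-resp Δ∘∇ ⟩∘⟨refl ⟩
    τ ∘ ((((∇ ⊗₁ ∇) ∘ (τ ∘ (Δ₀ ⊗₁ Δ₀))) ⊗₁ id) ∘ α)
      ≈⟨ refl⟩∘⟨ reassoc-≈ refl ∘⊗id⁻₃ assoc² ⟩
    τ ∘ (((∇ ⊗₁ ∇) ⊗₁ id) ∘ ((τ ⊗₁ id) ∘ (((Δ₀ ⊗₁ Δ₀) ⊗₁ id) ∘ α)))
      ≈⟨ refl⟩∘⟨ refl⟩∘⟨ refl⟩∘⟨ α-natural ⟨
    τ ∘ (((∇ ⊗₁ ∇) ⊗₁ id) ∘ ((τ ⊗₁ id) ∘ (α ∘ (Δ₀ ⊗₁ (Δ₀ ⊗₁ id)))))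
      ≈⟨ swapˡ (trans (refl⟩∘⟨ (refl ⟩⊗⟨ sym ⊗-identity)) τ-natural) ⟩
    ((∇ ⊗₁ id) ⊗₁ (∇ ⊗₁ id)) ∘ (τ ∘ ((τ ⊗₁ id) ∘ (α ∘ (Δ₀ ⊗₁ (Δ₀ ⊗₁ id)))))
      ≈⟨ refl⟩∘⟨ reassoc-≈ assoc² τ∘τ⊗id∘α assoc² ⟩
    ((∇ ⊗₁ id) ⊗₁ (∇ ⊗₁ id)) ∘ ((α ⊗₁ α) ∘ (τ ∘ ((id ⊗₁ τ) ∘ (Δ₀ ⊗₁ (Δ₀ ⊗₁ id)))))
      ≈⟨ refl⟩∘⟨ refl⟩∘⟨ refl⟩∘⟨ trans (sym serialize₁₂) ⊗-factorʳ ⟨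
    ((∇ ⊗₁ id) ⊗₁ (∇ ⊗₁ id)) ∘ ((α ⊗₁ α) ∘ (τ ∘ ((Δ₀ ⊗₁ id) ∘ (id ⊗₁ (τ ∘ (Δ₀ ⊗₁ id))))))
      ≈⟨ reassoc-≈ refl ⊗-homomorphism assoc ⟨
    (((∇ ⊗₁ id) ∘ α) ⊗₁ ((∇ ⊗₁ id) ∘ α)) ∘ (τ ∘ ((Δ₀ ⊗₁ id) ∘ (id ⊗₁ (τ ∘ (Δ₀ ⊗₁ id)))))
      ≈⟨ refl⟩∘⟨ assoc ⟨
    (((∇ ⊗₁ id) ∘ α) ⊗₁ ((∇ ⊗₁ id) ∘ α)) ∘ ((τ ∘ (Δ₀ ⊗₁ id)) ∘ (id ⊗₁ (τ ∘ (Δ₀ ⊗₁ id)))) ∎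

  nKT∘μT : nKT ∘ μT ≈ nKT ∘ (id ⊗₁ nKT)
  nKT∘μT = begin
    (e₀ ∘ ρ) ∘ ((∇ ⊗₁ id) ∘ α)
      ≈⟨ assoc ⟩
    e₀ ∘ (ρ ∘ ((∇ ⊗₁ id) ∘ α))
      ≈⟨ refl⟩∘⟨ swapˡ ρ-natural ⟩
    e₀ ∘ (∇ ∘ (ρ ∘ α))
      ≈⟨ refl⟩∘⟨ refl⟩∘⟨ kellyʳ ⟩
    e₀ ∘ (∇ ∘ (id ⊗₁ ρ))
      ≈⟨ pullˡ e∘♯ ⟩
    (ℓ ∘ (e₀ ⊗₁ e₀)) ∘ (id ⊗₁ ρ)
      ≈⟨ trans assoc (refl⟩∘⟨ trans ⊗-∘ (identityʳ ⟩⊗⟨ refl)) ⟩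
    ℓ ∘ (e₀ ⊗₁ (e₀ ∘ ρ))
      ≈⟨ ℓK≈ρK ⟩∘⟨refl ⟩
    ρ ∘ (e₀ ⊗₁ (e₀ ∘ ρ))
      ≈⟨ refl⟩∘⟨ trans ⊗-∘ (identityʳ ⟩⊗⟨ identityˡ) ⟨
    ρ ∘ ((e₀ ⊗₁ id) ∘ (id ⊗₁ (e₀ ∘ ρ)))
      ≈⟨ swapˡ (sym ρ-natural) ⟨
    e₀ ∘ (ρ ∘ (id ⊗₁ (e₀ ∘ ρ)))
      ≈⟨ assoc ⟨
    (e₀ ∘ ρ) ∘ (id ⊗₁ (e₀ ∘ ρ)) ∎

  nT∘ηT : ∀ {X Y} → nT ∘ ηT {X ⊗₀ Y} ≈ ηT ⊗₁ ηT
  nT∘ηT = begin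
    (τ ∘ (Δ₀ ⊗₁ id)) ∘ ((u ⊗₁ id) ∘ ℓ⁻¹)
      ≈⟨ assoc ⟩
    τ ∘ ((Δ₀ ⊗₁ id) ∘ ((u ⊗₁ id) ∘ ℓ⁻¹))
      ≈⟨ refl⟩∘⟨ pullˡ ∘⊗id ⟩
    τ ∘ (((Δ₀ ∘ u) ⊗₁ id) ∘ ℓ⁻¹)
      ≈⟨ refl⟩∘⟨ trans (⊗id-resp Δ∘u ⟩∘⟨refl) (trans (∘⊗id⁻ ⟩∘⟨refl) assoc) ⟩
    τ ∘ (((u ⊗₁ u) ⊗₁ id) ∘ ((ℓ⁻¹ ⊗₁ id) ∘ ℓ⁻¹))
      ≈⟨ swapˡ (trans (refl⟩∘⟨ (refl ⟩⊗⟨ sym ⊗-identity)) τ-natural) ⟩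
    ((u ⊗₁ id) ⊗₁ (u ⊗₁ id)) ∘ (τ ∘ ((ℓ⁻¹ ⊗₁ id) ∘ ℓ⁻¹))
      ≈⟨ refl⟩∘⟨ τ∘ℓ⁻¹⊗id∘ℓ⁻¹ ⟩
    ((u ⊗₁ id) ⊗₁ (u ⊗₁ id)) ∘ (ℓ⁻¹ ⊗₁ ℓ⁻¹)
      ≈⟨ ⊗-∘ ⟩
    ((u ⊗₁ id) ∘ ℓ⁻¹) ⊗₁ ((u ⊗₁ id) ∘ ℓ⁻¹) ∎

  nKT∘ηT : nKT ∘ ηT ≈ id
  nKT∘ηT = begin
    (e₀ ∘ ρ) ∘ ((u ⊗₁ id) ∘ ℓ⁻¹)
      ≈⟨ assoc ⟩
    e₀ ∘ (ρ ∘ ((u ⊗₁ id) ∘ ℓ⁻¹))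
      ≈⟨ refl⟩∘⟨ swapˡ ρ-natural ⟩
    e₀ ∘ (u ∘ (ρ ∘ ℓ⁻¹))
      ≈⟨ pullˡ e∘u ⟩
    id ∘ (ρ ∘ ℓ⁻¹)
      ≈⟨ identityˡ ⟩
    ρ ∘ ℓ⁻¹
      ≈⟨ ℓK≈ρK ⟩∘⟨refl ⟨
    ℓ ∘ ℓ⁻¹
      ≈⟨ ℓ-isoʳ ⟩
    id ∎

  λT-natural : ∀ {X Y} {f : Hom X Y} → λT ∘ (id ⊗₁ !₁ f) ≈ !₁ (id ⊗₁ f) ∘ λT
  λT-natural = trans assoc (trans (refl⟩∘⟨ ⊗-swap) (trans (pullˡ m-id⊗) assoc))

  λT∘μT : ∀ {X} → λT {X} ∘ μT ≈ !₁ μT ∘ (λT ∘ (id ⊗₁ λT))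
  λT∘μT = begin
    (m ∘ (δ₀ ⊗₁ id)) ∘ ((∇ ⊗₁ id) ∘ α)
      ≈⟨ assoc ⟩
    m ∘ ((δ₀ ⊗₁ id) ∘ ((∇ ⊗₁ id) ∘ α))
      ≈⟨ refl⟩∘⟨ pullˡ ∘⊗id ⟩
    m ∘ (((δ₀ ∘ ∇) ⊗₁ id) ∘ α)
      ≈⟨ refl⟩∘⟨ ⊗id-resp δ∘♯ ⟩∘⟨refl ⟩
    m ∘ (((∇ ♯) ⊗₁ id) ∘ α)
      ≈⟨ refl⟩∘⟨ trans (∘⊗id⁻ ⟩∘⟨refl) assoc ⟩
    m ∘ ((!₁ ∇ ⊗₁ id) ∘ (((m ∘ (δ₀ ⊗₁ δ₀)) ⊗₁ id) ∘ α))
      ≈⟨ swapˡ m-⊗id ⟩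
    !₁ (∇ ⊗₁ id) ∘ (m ∘ (((m ∘ (δ₀ ⊗₁ δ₀)) ⊗₁ id) ∘ α))
      ≈⟨ refl⟩∘⟨ refl⟩∘⟨ trans (∘⊗id⁻ ⟩∘⟨refl) assoc ⟩
    !₁ (∇ ⊗₁ id) ∘ (m ∘ ((m ⊗₁ id) ∘ (((δ₀ ⊗₁ δ₀) ⊗₁ id) ∘ α)))
      ≈⟨ refl⟩∘⟨ refl⟩∘⟨ refl⟩∘⟨ α-natural ⟨
    !₁ (∇ ⊗₁ id) ∘ (m ∘ ((m ⊗₁ id) ∘ (α ∘ (δ₀ ⊗₁ (δ₀ ⊗₁ id)))))
      ≈⟨ refl⟩∘⟨ reassoc-≈ assoc² m-assoc assoc² ⟩
    !₁ (∇ ⊗₁ id) ∘ (!₁ α ∘ (m ∘ ((id ⊗₁ m) ∘ (δ₀ ⊗₁ (δ₀ ⊗₁ id)))))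
      ≈⟨ refl⟩∘⟨ refl⟩∘⟨ refl⟩∘⟨ trans (sym serialize₁₂) ⊗-factorʳ ⟨
    !₁ (∇ ⊗₁ id) ∘ (!₁ α ∘ (m ∘ ((δ₀ ⊗₁ id) ∘ (id ⊗₁ (m ∘ (δ₀ ⊗₁ id))))))
      ≈⟨ reassoc-≈ assoc (sym !-homomorphism) refl ⟩
    !₁ ((∇ ⊗₁ id) ∘ α) ∘ (m ∘ ((δ₀ ⊗₁ id) ∘ (id ⊗₁ (m ∘ (δ₀ ⊗₁ id)))))
      ≈⟨ refl⟩∘⟨ assoc ⟨
    !₁ ((∇ ⊗₁ id) ∘ α) ∘ ((m ∘ (δ₀ ⊗₁ id)) ∘ (id ⊗₁ (m ∘ (δ₀ ⊗₁ id)))) ∎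

  λT∘ηT : ∀ {X} → λT {X} ∘ ηT ≈ !₁ ηT
  λT∘ηT = begin
    (m ∘ (δ₀ ⊗₁ id)) ∘ ((u ⊗₁ id) ∘ ℓ⁻¹)
      ≈⟨ assoc ⟩
    m ∘ ((δ₀ ⊗₁ id) ∘ ((u ⊗₁ id) ∘ ℓ⁻¹))
      ≈⟨ refl⟩∘⟨ pullˡ ∘⊗id ⟩
    m ∘ (((δ₀ ∘ u) ⊗₁ id) ∘ ℓ⁻¹)
      ≈⟨ refl⟩∘⟨ trans (⊗id-resp δ∘u ⟩∘⟨refl) (trans (∘⊗id⁻ ⟩∘⟨refl) assoc) ⟩
    m ∘ ((!₁ u ⊗₁ id) ∘ ((mK ⊗₁ id) ∘ ℓ⁻¹))
      ≈⟨ swapˡ m-⊗id ⟩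
    !₁ (u ⊗₁ id) ∘ (m ∘ ((mK ⊗₁ id) ∘ ℓ⁻¹))
      ≈⟨ refl⟩∘⟨ m∘mK⊗id∘ℓ⁻¹ ⟩
    !₁ (u ⊗₁ id) ∘ !₁ ℓ⁻¹
      ≈⟨ !-homomorphism ⟨
    !₁ ((u ⊗₁ id) ∘ ℓ⁻¹) ∎

  δ∘λT : ∀ {X} → δ {P ⊗₀ X} ∘ λT ≈ !₁ λT ∘ (λT ∘ (id ⊗₁ δ))
  δ∘λT = begin
    δ ∘ (m ∘ (δ₀ ⊗₁ id))
      ≈⟨ reassoc-≈ assoc δ-m assoc² ⟩
    !₁ m ∘ (m ∘ ((δ ⊗₁ δ) ∘ (δ₀ ⊗₁ id)))
      ≈⟨ refl⟩∘⟨ refl⟩∘⟨ trans ⊗-∘ (sym comonad-assoc ⟩⊗⟨ identityʳ) ⟩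
    !₁ m ∘ (m ∘ ((!₁ δ₀ ∘ δ₀) ⊗₁ δ))
      ≈⟨ refl⟩∘⟨ refl⟩∘⟨ ⊗-factorˡ ⟩
    !₁ m ∘ (m ∘ ((!₁ δ₀ ⊗₁ id) ∘ (δ₀ ⊗₁ δ)))
      ≈⟨ refl⟩∘⟨ swapˡ m-⊗id ⟩
    !₁ m ∘ (!₁ (δ₀ ⊗₁ id) ∘ (m ∘ (δ₀ ⊗₁ δ)))
      ≈⟨ refl⟩∘⟨ refl⟩∘⟨ refl⟩∘⟨ serialize₁₂ ⟩
    !₁ m ∘ (!₁ (δ₀ ⊗₁ id) ∘ (m ∘ ((δ₀ ⊗₁ id) ∘ (id ⊗₁ δ))))
      ≈⟨ reassoc-≈ assoc (sym !-homomorphism) refl ⟩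
    !₁ (m ∘ (δ₀ ⊗₁ id)) ∘ (m ∘ ((δ₀ ⊗₁ id) ∘ (id ⊗₁ δ)))
      ≈⟨ refl⟩∘⟨ assoc ⟨
    !₁ (m ∘ (δ₀ ⊗₁ id)) ∘ ((m ∘ (δ₀ ⊗₁ id)) ∘ (id ⊗₁ δ)) ∎

  ε∘λT : ∀ {X} → ε {P ⊗₀ X} ∘ λT ≈ id ⊗₁ ε
  ε∘λT = trans (pullˡ ε-m) (trans ⊗-∘ (comonad-idˡ ⟩⊗⟨ identityʳ))

  λT-m : ∀ {X Y} → !₁ nT ∘ (λT {X ⊗₀ Y} ∘ (id ⊗₁ m)) ≈ m ∘ ((λT ⊗₁ λT) ∘ nT)
  λT-m = begin
    !₁ (τ ∘ (Δ₀ ⊗₁ id)) ∘ ((m ∘ (δ₀ ⊗₁ id)) ∘ (id ⊗₁ m))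
      ≈⟨ !-homomorphism ⟩∘⟨ assoc ⟩
    (!₁ τ ∘ !₁ (Δ₀ ⊗₁ id)) ∘ (m ∘ ((δ₀ ⊗₁ id) ∘ (id ⊗₁ m)))
      ≈⟨ assoc ⟩
    !₁ τ ∘ (!₁ (Δ₀ ⊗₁ id) ∘ (m ∘ ((δ₀ ⊗₁ id) ∘ (id ⊗₁ m))))
      ≈⟨ refl⟩∘⟨ refl⟩∘⟨ refl⟩∘⟨ sym serialize₁₂ ⟩
    !₁ τ ∘ (!₁ (Δ₀ ⊗₁ id) ∘ (m ∘ (δ₀ ⊗₁ m)))
      ≈⟨ refl⟩∘⟨ swapˡ m-⊗id ⟨
    !₁ τ ∘ (m ∘ ((!₁ Δ₀ ⊗₁ id) ∘ (δ₀ ⊗₁ m)))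
      ≈⟨ refl⟩∘⟨ refl⟩∘⟨ trans ⊗-∘ (!Δ-δ ⟩⊗⟨ identityˡ) ⟩
    !₁ τ ∘ (m ∘ ((m ∘ ((δ₀ ⊗₁ δ₀) ∘ Δ₀)) ⊗₁ m))
      ≈⟨ refl⟩∘⟨ refl⟩∘⟨ trans ⊗-∘ (refl ⟩⊗⟨ identityʳ) ⟨
    !₁ τ ∘ (m ∘ ((m ⊗₁ m) ∘ (((δ₀ ⊗₁ δ₀) ∘ Δ₀) ⊗₁ id)))
      ≈⟨ reassoc-≈ assoc² m-τ assoc² ⟩
    m ∘ ((m ⊗₁ m) ∘ (τ ∘ (((δ₀ ⊗₁ δ₀) ∘ Δ₀) ⊗₁ id)))
      ≈⟨ refl⟩∘⟨ refl⟩∘⟨ refl⟩∘⟨ ∘⊗id⁻ ⟩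
    m ∘ ((m ⊗₁ m) ∘ (τ ∘ (((δ₀ ⊗₁ δ₀) ⊗₁ id) ∘ (Δ₀ ⊗₁ id))))
      ≈⟨ refl⟩∘⟨ refl⟩∘⟨ swapˡ (trans (refl⟩∘⟨ (refl ⟩⊗⟨ sym ⊗-identity)) τ-natural) ⟩
    m ∘ ((m ⊗₁ m) ∘ (((δ₀ ⊗₁ id) ⊗₁ (δ₀ ⊗₁ id)) ∘ (τ ∘ (Δ₀ ⊗₁ id))))
      ≈⟨ refl⟩∘⟨ pullˡ ⊗-∘ ⟩
    m ∘ (((m ∘ (δ₀ ⊗₁ id)) ⊗₁ (m ∘ (δ₀ ⊗₁ id))) ∘ (τ ∘ (Δ₀ ⊗₁ id))) ∎

  λT-mK : !₁ nKT ∘ (λT ∘ (id ⊗₁ mK)) ≈ mK ∘ nKT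
  λT-mK = begin
    !₁ (e₀ ∘ ρ) ∘ ((m ∘ (δ₀ ⊗₁ id)) ∘ (id ⊗₁ mK))
      ≈⟨ !-homomorphism ⟩∘⟨ assoc ⟩
    (!₁ e₀ ∘ !₁ ρ) ∘ (m ∘ ((δ₀ ⊗₁ id) ∘ (id ⊗₁ mK)))
      ≈⟨ assoc ⟩
    !₁ e₀ ∘ (!₁ ρ ∘ (m ∘ ((δ₀ ⊗₁ id) ∘ (id ⊗₁ mK))))
      ≈⟨ refl⟩∘⟨ refl⟩∘⟨ refl⟩∘⟨ ⊗-swap ⟩
    !₁ e₀ ∘ (!₁ ρ ∘ (m ∘ ((id ⊗₁ mK) ∘ (δ₀ ⊗₁ id))))
      ≈⟨ refl⟩∘⟨ reassoc-≈ assoc² m-unitʳ refl ⟩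
    !₁ e₀ ∘ (ρ ∘ (δ₀ ⊗₁ id))
      ≈⟨ refl⟩∘⟨ ρ-natural ⟩
    !₁ e₀ ∘ (δ₀ ∘ ρ)
      ≈⟨ pullˡ !e-δ ⟩
    (mK ∘ e₀) ∘ ρ
      ≈⟨ assoc ⟩
    mK ∘ (e₀ ∘ ρ) ∎

  isExponentialLiftingMonad : IsExponentialLiftingMonad 𝕏 M T₀ T₁ μT ηT nT nKT λT
  isExponentialLiftingMonad = record
    { T-resp-≈ = id⊗-resp
    ; T-identity = ⊗-identity
    ; T-homomorphism = id⊗∘⁻
    ; μ-natural = μT-natural
    ; η-natural = ηT-natural
    ; monad-assoc = μT-assoc
    ; monad-idˡ = μT∘T₁ηT
    ; monad-idʳ = μT∘ηT
    ; n-natural = nT-natural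
    ; n-assoc = nT-assoc
    ; n-unitˡ = nT-unitˡ
    ; n-unitʳ = nT-unitʳ
    ; n-symmetric = nT-symmetric
    ; μ-n = nT∘μT
    ; μ-nK = nKT∘μT
    ; η-n = nT∘ηT
    ; η-nK = nKT∘ηT
    ; λ-natural = λT-natural
    ; λ-μ = λT∘μT
    ; λ-η = λT∘ηT
    ; λ-δ = δ∘λT
    ; λ-ε = ε∘λT
    ; λ-m = λT-m
    ; λ-mK = λT-mK
    }

proposition7p3 : ∀ {o h r} (𝕏 : SymMonCat o h r) (Ad : Additive 𝕏)
                   (M : MonoidalCoalgebraModality 𝕏) (A : SymMonCat.Obj 𝕏) →
                 let open MonoidalCoalgebraModality M
                     open Prop73Data 𝕏 Ad M A
                 in IsCocommutativeBimonoid 𝕏 (!₀ A) ∇ u Δ e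
                    × IsExponentialLiftingMonad 𝕏 M T₀ T₁ μT ηT nT nKT λT
proposition7p3 𝕏 Ad M A =
  CocommutativeBimonoid.isCocommutativeBimonoid 𝕏 Ad M A ,
  ExponentialLiftingMonad.isExponentialLiftingMonad 𝕏 Ad M A
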